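{- Let $n\ge 3$ and let $\mathrm{peak}(\pi)$ be the number of indices $i$ with $2\le i\le n-1$ and $\pi(i-1)<\pi(i)>\pi(i+1)$, for $\pi\in S_n$. Then $$\overline{\mathrm{peak}}=\frac{n-2}{3}\chi^{(n)}-\frac{1}{n(n-1)}\Bigl(\chi^{(n-1,1)}+\chi^{(n-2,2)}+\chi^{(n-2,1,1)}+\chi^{(n-3,2,1)}\Bigr).$$
   Context: For $s:S_n\to\mathbb R$ the mean statistic is the class function $\overline s(\lambda)=\frac{1}{|C_\lambda|}\sum_{\pi\in C_\lambda}s(\pi)$ for $\lambda\vdash n$, where $C_\lambda$ is the conjugacy class of cycle type $\lambda$. $\chi^\mu$ is the irreducible character of $S_n$ indexed by $\mu\vdash n$. For $n\le 5$, where some indices are not partitions of $n$, $\chi^{\mu}$ stands for the class function given in terms of the numbers $p,q,r$ of parts of $\lambda$ of size $1,2,3$ by $\chi^{(n-2,2)}(\lambda)=\binom{p-1}{2}+q-1$ and $\chi^{(n-3,2,1)}(\lambda)=2\binom{p-1}{3}-p-r+2$ (so $\chi^{(n-2,2)}=0$ and $\chi^{(n-3,2,1)}=-\chi^{(n-2,1,1)}$ when $n=3$, and $\chi^{(n-3,2,1)}=0$ when $n=4$). -}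

module Defs where

open import Data.Nat using (ℕ; zero; suc; _+_; _*_; _∸_; _≥_; _<_; _<ᵇ_)
open import Data.Nat.Properties using (_≟_)
open import Data.Integer as ℤ using (ℤ; +_)
open import Data.Bool using (Bool; true; false; if_then_else_; _∧_; not)
open import Data.List using (List; []; _∷_; length; map; filter; allFin; upTo)
open import Data.Nat.ListAction using (sum)
open import Data.Bool.ListAction using (any; all)
open import Relation.Unary using (Decidable)
open import Data.List.Relation.Unary.All using (All)
open import Data.List.Relation.Unary.Linked using (Linked)
open import Data.Fin using (Fin; toℕ)
open import Data.Fin.Properties using () renaming (_≟_ to _≟ᶠ_)
open import Data.Vec using (Vec; lookup; toList)
open import Data.Product using (_×_)
open import Relation.Binary.PropositionalEquality using (_≡_)
open import Relation.Nullary.Decidable using (does)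

-- Permutations of {0,…,n-1} in one-line notation: π = (π(0), …, π(n-1)).

Perm : ℕ → Set
Perm n = Vec (Fin n) n

count : ∀ {A : Set} {P : A → Set} → Decidable P → List A → ℕ
count P? xs = length (filter P? xs)

-- π is a permutation: its one-line notation is an injective map Fin n → Fin n
-- (equivalently a bijection, Fin n being finite).
IsPerm : ∀ {n} → Perm n → Set
IsPerm {n} π = ∀ (i j : Fin n) → lookup π i ≡ lookup π j → i ≡ j

iter : ∀ {n} → Perm n → ℕ → Fin n → Fin n
iter π zero    i = i
iter π (suc k) i = lookup π (iter π k i)

first : (ℕ → Bool) → List ℕ → ℕ
first p []       = 0
first p (x ∷ xs) = if p x then x else first p xs

orbitLen : ∀ {n} → Perm n → Fin n → ℕ
orbitLen {n} π i = first (λ k → does (iter π k i ≟ᶠ i)) (map suc (upTo n))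

IsPartition : ℕ → List ℕ → Set
IsPartition n λp = Linked _≥_ λp × All (0 <_) λp × sum λp ≡ n

-- π has cycle type λ: for every k, the number of cycles of length k
-- (i.e. (#points lying in a k-cycle)/k) equals the number of parts of λ equal to k.
HasCycleType : ∀ {n} → Perm n → List ℕ → Set
HasCycleType {n} π λp =
  ∀ k → k * count (_≟ k) λp ≡ length (filter (λ i → orbitLen π i ≟ k) (allFin n))

peaksList : List ℕ → ℕ
peaksList (a ∷ b ∷ c ∷ rest) =
  (if (a <ᵇ b) ∧ (c <ᵇ b) then 1 else 0) + peaksList (b ∷ c ∷ rest)
peaksList _ = 0

peak : ∀ {n} → Perm n → ℕ
peak π = peaksList (map toℕ (toList π))

-- Characters of S_n via the Frobenius character formula:
--   χ^μ(λ) = [x^(μ+δ)] ( a_δ · p_λ ),   δ = (ℓ-1, …, 1, 0), ℓ = length μ,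
-- where a_δ = Σ_σ sgn(σ) x^(σ δ) is the Vandermonde alternant and
-- p_λ = Π_i (x_1^{λ_i} + … + x_ℓ^{λ_i}) the power-sum symmetric polynomial.
-- For a partition μ this is the irreducible character χ^μ; for a sequence μ
-- that is not a partition it is the usual (Jacobi–Trudi) extension.

subtractOne : ℕ → List ℕ → List (List ℕ)
subtractOne k []       = []
subtractOne k (x ∷ xs) =
  let rest = map (x ∷_) (subtractOne k xs) in
  if x <ᵇ k then rest else (x ∸ k ∷ xs) ∷ rest

sumℤ : List ℤ → ℤ
sumℤ []       = + 0
sumℤ (x ∷ xs) = x ℤ.+ sumℤ xs

distinct : List ℕ → Bool
distinct []       = true
distinct (x ∷ xs) = not (any (λ y → does (x ≟ y)) xs) ∧ distinct xs

-- number of pairs i < j with γ_i < γ_j (inversions w.r.t. decreasing order)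
ascents : List ℕ → ℕ
ascents []       = 0
ascents (x ∷ xs) = count (λ y → x Data.Nat.<? y) xs + ascents xs
  where import Data.Nat

parity : ℕ → ℤ
parity zero          = + 1
parity (suc zero)    = ℤ.- (+ 1)
parity (suc (suc k)) = parity k

-- [x^γ] a_δ  (δ of length = length γ)
altCoeff : List ℕ → ℤ
altCoeff γ =
  if distinct γ ∧ all (λ x → x <ᵇ length γ) γ
  then parity (ascents γ) else + 0

-- [x^γ] ( a_δ · p_λ )
frob : List ℕ → List ℕ → ℤ
frob γ []        = altCoeff γ
frob γ (k ∷ λp)  = sumℤ (map (λ γ' → frob γ' λp) (subtractOne k γ))

shift : List ℕ → List ℕ
shift []       = []
shift (m ∷ μ)  = (m + length μ) ∷ shift μ

χ : List ℕ → List ℕ → ℤ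
χ μ λp = frob (shift μ) λp

-- With at most three rows the Frobenius formula reads χ^μ(λ) = [x^(μ+δ)] a_δ p_λ, where
-- a_δ is the alternant in three variables. Multiplication by a_δ commutes with multiplication by p_λ, and
-- p_λ is homogeneous of degree n, so χ^μ(λ) is a signed sum of coefficients of y^b z^c in ∏ₖ (1 + y^k + z^k)
-- with b + c ≤ 3. These count the parts of λ of size 1, 2, 3, which gives χ^(n) = 1 and
-- 6 (χ^(n-1,1) + χ^(n-2,2) + χ^(n-2,1,1) + χ^(n-3,2,1)) = 2 p (p - 1) (p - 2) - 6 r.
--
-- Fix three consecutive positions x, x+1, x+2. Conjugating π by the six permutations σ of these
-- positions permutes the conjugacy class C, and the peak indicators at x+1 of the six σπσ⁻¹ add up to
-- 2 + [π cycles x ↦ x+1 ↦ x+2] + [π cycles x ↦ x+2 ↦ x+1] - 2 [π fixes x, x+1, x+2]. This depends only on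
-- the relative order of π(x), π(x+1), π(x+2) and x, x+1, x+2, so it is a finite check. Conjugation by
-- transpositions also shows that the number of π ∈ C fixing, resp. cycling, three distinct points does not
-- depend on the points; double counting gives n (n-1) (n-2) times it as |C| p (p-1) (p-2), resp. 3 r |C|.
-- So every one of the n - 2 positions contributes the same to the sum of peak over C.

module Submission where

open import Defs

module Characters where

  open import Data.Bool using (true; false; if_then_else_)
  open import Data.Bool.ListAction using (all)
  open import Data.Integer using (ℤ; +_; 0ℤ; 1ℤ; -1ℤ; _+_; _-_; _*_)
  import Data.Integer.Properties as ℤ
  open import Data.Integer.Tactic.RingSolver using (solve-∀)
  open import Data.List using (List; []; _∷_; map; length)
  import Data.List.Properties as List
  open import Data.List.Relation.Unary.All using (All; []; _∷_)
  open import Data.Nat as ℕ using (ℕ; zero; suc; _∸_; _<ᵇ_; _<_; z≤n; s≤s)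
  import Data.Nat.Properties as ℕ
  open import Data.Nat.ListAction using (sum)
  open import Data.Nat.Tactic.RingSolver using () renaming (solve-∀ to ℕ-solve-∀)
  open import Data.Product using (_×_; _,_)
  open import Function using (_⟨_⟩_)
  open import Relation.Binary.PropositionalEquality

  -- mulX k f a is the coefficient of x^a in x^k · Σᵢ f i xⁱ.
  mulX : ℕ → (ℕ → ℤ) → ℕ → ℤ
  mulX zero    f a       = f a
  mulX (suc k) f zero    = 0ℤ
  mulX (suc k) f (suc a) = mulX k f a

  mulX-guard : ∀ k f a → (if a <ᵇ k then 0ℤ else f (a ∸ k)) ≡ mulX k f a
  mulX-guard zero    f a       = refl
  mulX-guard (suc k) f zero    = refl
  mulX-guard (suc k) f (suc a) = mulX-guard k f a

  mulX-cong : ∀ k {f g} → (∀ x → f x ≡ g x) → ∀ a → mulX k f a ≡ mulX k g a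
  mulX-cong zero    f≗g a       = f≗g a
  mulX-cong (suc k) f≗g zero    = refl
  mulX-cong (suc k) f≗g (suc a) = mulX-cong k f≗g a

  mulX-0 : ∀ k a → mulX k (λ _ → 0ℤ) a ≡ 0ℤ
  mulX-0 zero    a       = refl
  mulX-0 (suc k) zero    = refl
  mulX-0 (suc k) (suc a) = mulX-0 k a

  mulX-+ : ∀ k f g a → mulX k (λ x → f x + g x) a ≡ mulX k f a + mulX k g a
  mulX-+ zero    f g a       = refl
  mulX-+ (suc k) f g zero    = refl
  mulX-+ (suc k) f g (suc a) = mulX-+ k f g a

  mulX-* : ∀ k s f a → mulX k (λ x → s * f x) a ≡ s * mulX k f a
  mulX-* zero    s f a       = refl
  mulX-* (suc k) s f zero    = sym (ℤ.*-zeroʳ s)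
  mulX-* (suc k) s f (suc a) = mulX-* k s f a

  mulX-mulX : ∀ e k f a → mulX e (mulX k f) a ≡ mulX (e ℕ.+ k) f a
  mulX-mulX zero    k f a       = refl
  mulX-mulX (suc e) k f zero    = refl
  mulX-mulX (suc e) k f (suc a) = mulX-mulX e k f a

  mulX-comm : ∀ e k f a → mulX e (mulX k f) a ≡ mulX k (mulX e f) a
  mulX-comm e k f a = begin
    mulX e (mulX k f) a  ≡⟨ mulX-mulX e k f a ⟩
    mulX (e ℕ.+ k) f a   ≡⟨ cong (λ d → mulX d f a) (ℕ.+-comm e k) ⟩
    mulX (k ℕ.+ e) f a   ≡⟨ mulX-mulX k e f a ⟨
    mulX k (mulX e f) a  ∎
    where open ≡-Reasoning

  mulX-swap : ∀ e k (f : ℕ → ℕ → ℤ) a b →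
              mulX e (λ x → mulX k (f x) b) a ≡ mulX k (λ y → mulX e (λ x → f x y) a) b
  mulX-swap zero    k f a       b = refl
  mulX-swap (suc e) k f zero    b = sym (mulX-0 k b)
  mulX-swap (suc e) k f (suc a) b = mulX-swap e k f a b

  mulX-< : ∀ {k a} f → a < k → mulX k f a ≡ 0ℤ
  mulX-< {suc k} {zero}  f _         = refl
  mulX-< {suc k} {suc a} f (s≤s a<k) = mulX-< f a<k

  mulX-+ˡ : ∀ k a f → mulX k f (k ℕ.+ a) ≡ f a
  mulX-+ˡ zero    a f = refl
  mulX-+ˡ (suc k) a f = mulX-+ˡ k a f

  -- Coefficient functions of power series in three variables x, y, z.
  Series : Set
  Series = ℕ → ℕ → ℕ → ℤ

  _≗₃_ : Series → Series → Set
  f ≗₃ g = ∀ a b c → f a b c ≡ g a b c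

  one : Series
  one zero zero zero = 1ℤ
  one _    _    _    = 0ℤ

  mulMonomial : ℕ → ℕ → ℕ → Series → Series
  mulMonomial e₁ e₂ e₃ f a b c = mulX e₁ (λ a′ → mulX e₂ (λ b′ → mulX e₃ (f a′ b′) c) b) a

  Polynomial : Set
  Polynomial = List (ℤ × ℕ × ℕ × ℕ)

  mulPolynomial : Polynomial → Series → Series
  mulPolynomial []                        f a b c = 0ℤ
  mulPolynomial ((s , e₁ , e₂ , e₃) ∷ P) f a b c = s * mulMonomial e₁ e₂ e₃ f a b c + mulPolynomial P f a b c

  mulPowerSum : ℕ → Series → Series
  mulPowerSum k f a b c = mulX k (λ a′ → f a′ b c) a + mulX k (λ b′ → f a b′ c) b + mulX k (f a b) c

  mulPowerSums : List ℕ → Series → Series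
  mulPowerSums []       f = f
  mulPowerSums (k ∷ ks) f = mulPowerSum k (mulPowerSums ks f)

  mulPowerSum-cong : ∀ k {f g} → f ≗₃ g → mulPowerSum k f ≗₃ mulPowerSum k g
  mulPowerSum-cong k f≗g a b c = cong₂ _+_
    (cong₂ _+_ (mulX-cong k (λ a′ → f≗g a′ b c) a) (mulX-cong k (λ b′ → f≗g a b′ c) b))
    (mulX-cong k (f≗g a b) c)

  mulPowerSums-cong : ∀ ks {f g} → f ≗₃ g → mulPowerSums ks f ≗₃ mulPowerSums ks g
  mulPowerSums-cong []       f≗g = f≗g
  mulPowerSums-cong (k ∷ ks) f≗g = mulPowerSum-cong k (mulPowerSums-cong ks f≗g)

  mulPowerSum-0 : ∀ k a b c → mulPowerSum k (λ _ _ _ → 0ℤ) a b c ≡ 0ℤ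
  mulPowerSum-0 k a b c rewrite mulX-0 k a | mulX-0 k b | mulX-0 k c = refl

  mulPowerSum-+ : ∀ k f g a b c →
    mulPowerSum k (λ a b c → f a b c + g a b c) a b c ≡ mulPowerSum k f a b c + mulPowerSum k g a b c
  mulPowerSum-+ k f g a b c
    rewrite mulX-+ k (λ a′ → f a′ b c) (λ a′ → g a′ b c) a
          | mulX-+ k (λ b′ → f a b′ c) (λ b′ → g a b′ c) b
          | mulX-+ k (f a b) (g a b) c
    = regroup (mulX k (λ a′ → f a′ b c) a) (mulX k (λ a′ → g a′ b c) a) (mulX k (λ b′ → f a b′ c) b)
              (mulX k (λ b′ → g a b′ c) b) (mulX k (f a b) c) (mulX k (g a b) c)
    where
    regroup : ∀ x x′ y y′ z z′ → x + x′ + (y + y′) + (z + z′) ≡ x + y + z + (x′ + y′ + z′)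
    regroup = solve-∀

  mulPowerSum-* : ∀ k s f a b c → mulPowerSum k (λ a b c → s * f a b c) a b c ≡ s * mulPowerSum k f a b c
  mulPowerSum-* k s f a b c
    rewrite mulX-* k s (λ a′ → f a′ b c) a | mulX-* k s (λ b′ → f a b′ c) b | mulX-* k s (f a b) c
    = distrib (mulX k (λ a′ → f a′ b c) a) (mulX k (λ b′ → f a b′ c) b) (mulX k (f a b) c)
    where
    distrib : ∀ x y z → s * x + s * y + s * z ≡ s * (x + y + z)
    distrib x y z = sym (trans (ℤ.*-distribˡ-+ s (x + y) z) (cong (_+ s * z) (ℤ.*-distribˡ-+ s x y)))

  mulMonomial-+ : ∀ e₁ e₂ e₃ f g a b c →
    mulMonomial e₁ e₂ e₃ (λ a b c → f a b c + g a b c) a b c ≡ mulMonomial e₁ e₂ e₃ f a b c + mulMonomial e₁ e₂ e₃ g a b c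
  mulMonomial-+ e₁ e₂ e₃ f g a b c = begin
    mulX e₁ (λ a′ → mulX e₂ (λ b′ → mulX e₃ (λ c′ → f a′ b′ c′ + g a′ b′ c′) c) b) a
      ≡⟨ mulX-cong e₁ (λ a′ → mulX-cong e₂ (λ b′ → mulX-+ e₃ (f a′ b′) (g a′ b′) c) b) a ⟩
    mulX e₁ (λ a′ → mulX e₂ (λ b′ → F a′ b′ + G a′ b′) b) a
      ≡⟨ mulX-cong e₁ (λ a′ → mulX-+ e₂ (F a′) (G a′) b) a ⟩
    mulX e₁ (λ a′ → mulX e₂ (F a′) b + mulX e₂ (G a′) b) a
      ≡⟨ mulX-+ e₁ (λ a′ → mulX e₂ (F a′) b) (λ a′ → mulX e₂ (G a′) b) a ⟩
    mulMonomial e₁ e₂ e₃ f a b c + mulMonomial e₁ e₂ e₃ g a b c ∎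
    where
    open ≡-Reasoning
    F G : ℕ → ℕ → ℤ
    F a′ b′ = mulX e₃ (f a′ b′) c
    G a′ b′ = mulX e₃ (g a′ b′) c

  mulPowerSum-mulMonomial : ∀ k e₁ e₂ e₃ f →
    mulPowerSum k (mulMonomial e₁ e₂ e₃ f) ≗₃ mulMonomial e₁ e₂ e₃ (mulPowerSum k f)
  mulPowerSum-mulMonomial k e₁ e₂ e₃ f a b c = begin
    mulPowerSum k (mulMonomial e₁ e₂ e₃ f) a b c
      ≡⟨ cong₂ _+_ (cong₂ _+_ along-x along-y) along-z ⟩
    mulMonomial e₁ e₂ e₃ Fx a b c + mulMonomial e₁ e₂ e₃ Fy a b c + mulMonomial e₁ e₂ e₃ Fz a b c
      ≡⟨ cong (_+ mulMonomial e₁ e₂ e₃ Fz a b c) (mulMonomial-+ e₁ e₂ e₃ Fx Fy a b c) ⟨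
    mulMonomial e₁ e₂ e₃ (λ a b c → Fx a b c + Fy a b c) a b c + mulMonomial e₁ e₂ e₃ Fz a b c
      ≡⟨ mulMonomial-+ e₁ e₂ e₃ (λ a b c → Fx a b c + Fy a b c) Fz a b c ⟨
    mulMonomial e₁ e₂ e₃ (mulPowerSum k f) a b c ∎
    where
    open ≡-Reasoning
    Fx Fy Fz : Series
    Fx a b c = mulX k (λ a′ → f a′ b c) a
    Fy a b c = mulX k (λ b′ → f a b′ c) b
    Fz a b c = mulX k (f a b) c
    along-x : mulX k (λ a′ → mulMonomial e₁ e₂ e₃ f a′ b c) a ≡ mulMonomial e₁ e₂ e₃ Fx a b c
    along-x = trans (mulX-comm k e₁ _ a) (mulX-cong e₁ (λ a′ →
      trans (mulX-swap k e₂ (λ a″ b′ → mulX e₃ (f a″ b′) c) a′ b)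
            (mulX-cong e₂ (λ b′ → mulX-swap k e₃ (λ a″ → f a″ b′) a′ c) b)) a)
    along-y : mulX k (λ b′ → mulMonomial e₁ e₂ e₃ f a b′ c) b ≡ mulMonomial e₁ e₂ e₃ Fy a b c
    along-y = trans (sym (mulX-swap e₁ k (λ a′ b′ → mulX e₂ (λ b″ → mulX e₃ (f a′ b″) c) b′) a b))
      (mulX-cong e₁ (λ a′ → trans (mulX-comm k e₂ _ b)
        (mulX-cong e₂ (λ b′ → mulX-swap k e₃ (f a′) b′ c) b)) a)
    along-z : mulX k (mulMonomial e₁ e₂ e₃ f a b) c ≡ mulMonomial e₁ e₂ e₃ Fz a b c
    along-z = trans (sym (mulX-swap e₁ k (λ a′ c′ → mulX e₂ (λ b′ → mulX e₃ (f a′ b′) c′) b) a c))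
      (mulX-cong e₁ (λ a′ → trans (sym (mulX-swap e₂ k (λ b′ → mulX e₃ (f a′ b′)) b c))
        (mulX-cong e₂ (λ b′ → mulX-comm k e₃ (f a′ b′) c) b)) a)

  mulPowerSum-mulPolynomial : ∀ k P f → mulPowerSum k (mulPolynomial P f) ≗₃ mulPolynomial P (mulPowerSum k f)
  mulPowerSum-mulPolynomial k []                        f a b c = mulPowerSum-0 k a b c
  mulPowerSum-mulPolynomial k ((s , e₁ , e₂ , e₃) ∷ P) f a b c = begin
    mulPowerSum k (λ a b c → s * mulMonomial e₁ e₂ e₃ f a b c + mulPolynomial P f a b c) a b c
      ≡⟨ mulPowerSum-+ k (λ a b c → s * mulMonomial e₁ e₂ e₃ f a b c) (mulPolynomial P f) a b c ⟩
    mulPowerSum k (λ a b c → s * mulMonomial e₁ e₂ e₃ f a b c) a b c + mulPowerSum k (mulPolynomial P f) a b c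
      ≡⟨ cong₂ _+_ (mulPowerSum-* k s (mulMonomial e₁ e₂ e₃ f) a b c) (mulPowerSum-mulPolynomial k P f a b c) ⟩
    s * mulPowerSum k (mulMonomial e₁ e₂ e₃ f) a b c + mulPolynomial P (mulPowerSum k f) a b c
      ≡⟨ cong (λ t → s * t + _) (mulPowerSum-mulMonomial k e₁ e₂ e₃ f a b c) ⟩
    mulPolynomial ((s , e₁ , e₂ , e₃) ∷ P) (mulPowerSum k f) a b c ∎
    where open ≡-Reasoning

  mulPolynomial-cong : ∀ P {f g} → f ≗₃ g → mulPolynomial P f ≗₃ mulPolynomial P g
  mulPolynomial-cong []                        f≗g a b c = refl
  mulPolynomial-cong ((s , e₁ , e₂ , e₃) ∷ P) f≗g a b c = cong₂ (λ u v → s * u + v)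
    (mulX-cong e₁ (λ a′ → mulX-cong e₂ (λ b′ → mulX-cong e₃ (f≗g a′ b′) c) b) a)
    (mulPolynomial-cong P f≗g a b c)

  mulPowerSums-mulPolynomial : ∀ ks P f → mulPowerSums ks (mulPolynomial P f) ≗₃ mulPolynomial P (mulPowerSums ks f)
  mulPowerSums-mulPolynomial []       P f a b c = refl
  mulPowerSums-mulPolynomial (k ∷ ks) P f a b c =
    trans (mulPowerSum-cong k (mulPowerSums-mulPolynomial ks P f) a b c)
          (mulPowerSum-mulPolynomial k P (mulPowerSums ks f) a b c)

  sumℤ-subtractOne-∷ : ∀ (F : List ℕ → ℤ) k x γ →
    sumℤ (map F (subtractOne k (x ∷ γ))) ≡ mulX k (λ x′ → F (x′ ∷ γ)) x + sumℤ (map (λ γ′ → F (x ∷ γ′)) (subtractOne k γ))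
  sumℤ-subtractOne-∷ F k x γ = trans guarded (cong (_+ rest) (mulX-guard k (λ x′ → F (x′ ∷ γ)) x))
    where
    rest : ℤ
    rest = sumℤ (map (λ γ′ → F (x ∷ γ′)) (subtractOne k γ))
    rest-map : sumℤ (map F (map (x ∷_) (subtractOne k γ))) ≡ rest
    rest-map = cong sumℤ (sym (List.map-∘ (subtractOne k γ)))
    guarded : sumℤ (map F (subtractOne k (x ∷ γ))) ≡
              (if x <ᵇ k then 0ℤ else F (x ∸ k ∷ γ)) + rest
    guarded with x <ᵇ k
    ... | true  = trans rest-map (sym (ℤ.+-identityˡ rest))
    ... | false = cong (λ t → F (x ∸ k ∷ γ) + t) rest-map

  altCoeff₃ : Series
  altCoeff₃ a b c = altCoeff (a ∷ b ∷ c ∷ [])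

  frob₃-step : ∀ k ks a b c → frob (a ∷ b ∷ c ∷ []) (k ∷ ks) ≡ mulPowerSum k (λ a b c → frob (a ∷ b ∷ c ∷ []) ks) a b c
  frob₃-step k ks a b c = begin
    frob (a ∷ b ∷ c ∷ []) (k ∷ ks)
      ≡⟨ sumℤ-subtractOne-∷ (λ γ → frob γ ks) k a (b ∷ c ∷ []) ⟩
    X + sumℤ (map (λ γ → frob (a ∷ γ) ks) (subtractOne k (b ∷ c ∷ [])))
      ≡⟨ cong (λ t → X + t) (sumℤ-subtractOne-∷ (λ γ → frob (a ∷ γ) ks) k b (c ∷ [])) ⟩
    X + (Y + sumℤ (map (λ γ → frob (a ∷ b ∷ γ) ks) (subtractOne k (c ∷ []))))
      ≡⟨ cong (λ t → X + (Y + t)) (sumℤ-subtractOne-∷ (λ γ → frob (a ∷ b ∷ γ) ks) k c []) ⟩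
    X + (Y + (Z + 0ℤ))
      ≡⟨ regroup X Y Z ⟩
    X + Y + Z ∎
    where
    open ≡-Reasoning
    X = mulX k (λ a′ → frob (a′ ∷ b ∷ c ∷ []) ks) a
    Y = mulX k (λ b′ → frob (a ∷ b′ ∷ c ∷ []) ks) b
    Z = mulX k (λ c′ → frob (a ∷ b ∷ c′ ∷ []) ks) c
    regroup : ∀ x y z → x + (y + (z + 0ℤ)) ≡ x + y + z
    regroup = solve-∀

  -- the alternant a_δ = Σ_σ sgn σ · x^(σ δ) for δ = (2, 1, 0)
  alternant₃ : Polynomial
  alternant₃ = (1ℤ , 2 , 1 , 0) ∷ (-1ℤ , 2 , 0 , 1) ∷ (-1ℤ , 1 , 2 , 0)
             ∷ (1ℤ , 1 , 0 , 2) ∷ (1ℤ , 0 , 2 , 1) ∷ (-1ℤ , 0 , 1 , 2) ∷ []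

  altCoeff-outOfRange : ∀ γ → all (λ x → x <ᵇ length γ) γ ≡ false → altCoeff γ ≡ 0ℤ
  altCoeff-outOfRange γ out rewrite out with distinct γ
  ... | true  = refl
  ... | false = refl

  altCoeff₃-outOfRange : ∀ a b c → all (λ x → x <ᵇ 3) (a ∷ b ∷ c ∷ []) ≡ false → altCoeff₃ a b c ≡ 0ℤ
  altCoeff₃-outOfRange a b c = altCoeff-outOfRange (a ∷ b ∷ c ∷ [])

  -- a finite check: both sides vanish as soon as an exponent exceeds 2
  altCoeff₃-expand : altCoeff₃ ≗₃ mulPolynomial alternant₃ one
  altCoeff₃-expand 0 0 0 = refl
  altCoeff₃-expand 0 0 1 = refl
  altCoeff₃-expand 0 0 2 = refl
  altCoeff₃-expand 0 0 (suc (suc (suc _))) = refl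
  altCoeff₃-expand 0 1 0 = refl
  altCoeff₃-expand 0 1 1 = refl
  altCoeff₃-expand 0 1 2 = refl
  altCoeff₃-expand 0 1 (suc (suc (suc _))) = refl
  altCoeff₃-expand 0 2 0 = refl
  altCoeff₃-expand 0 2 1 = refl
  altCoeff₃-expand 0 2 2 = refl
  altCoeff₃-expand 0 2 (suc (suc (suc _))) = refl
  altCoeff₃-expand 0 (suc (suc (suc _))) 0 = refl
  altCoeff₃-expand 0 (suc (suc (suc _))) 1 = refl
  altCoeff₃-expand 0 (suc (suc (suc _))) 2 = refl
  altCoeff₃-expand 0 b@(suc (suc (suc _))) c@(suc (suc (suc _))) = altCoeff₃-outOfRange 0 b c refl
  altCoeff₃-expand 1 0 0 = refl
  altCoeff₃-expand 1 0 1 = refl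
  altCoeff₃-expand 1 0 2 = refl
  altCoeff₃-expand 1 0 (suc (suc (suc _))) = refl
  altCoeff₃-expand 1 1 0 = refl
  altCoeff₃-expand 1 1 1 = refl
  altCoeff₃-expand 1 1 2 = refl
  altCoeff₃-expand 1 1 (suc (suc (suc _))) = refl
  altCoeff₃-expand 1 2 0 = refl
  altCoeff₃-expand 1 2 1 = refl
  altCoeff₃-expand 1 2 2 = refl
  altCoeff₃-expand 1 2 (suc (suc (suc _))) = refl
  altCoeff₃-expand 1 (suc (suc (suc _))) 0 = refl
  altCoeff₃-expand 1 (suc (suc (suc _))) 1 = refl
  altCoeff₃-expand 1 (suc (suc (suc _))) 2 = refl
  altCoeff₃-expand 1 b@(suc (suc (suc _))) c@(suc (suc (suc _))) = altCoeff₃-outOfRange 1 b c refl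
  altCoeff₃-expand 2 0 0 = refl
  altCoeff₃-expand 2 0 1 = refl
  altCoeff₃-expand 2 0 2 = refl
  altCoeff₃-expand 2 0 (suc (suc (suc _))) = refl
  altCoeff₃-expand 2 1 0 = refl
  altCoeff₃-expand 2 1 1 = refl
  altCoeff₃-expand 2 1 2 = refl
  altCoeff₃-expand 2 1 (suc (suc (suc _))) = refl
  altCoeff₃-expand 2 2 0 = refl
  altCoeff₃-expand 2 2 1 = refl
  altCoeff₃-expand 2 2 2 = refl
  altCoeff₃-expand 2 2 (suc (suc (suc _))) = refl
  altCoeff₃-expand 2 (suc (suc (suc _))) 0 = refl
  altCoeff₃-expand 2 (suc (suc (suc _))) 1 = refl
  altCoeff₃-expand 2 (suc (suc (suc _))) 2 = refl
  altCoeff₃-expand 2 b@(suc (suc (suc _))) c@(suc (suc (suc _))) = altCoeff₃-outOfRange 2 b c refl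
  altCoeff₃-expand (suc (suc (suc _))) 0 0 = refl
  altCoeff₃-expand (suc (suc (suc _))) 0 1 = refl
  altCoeff₃-expand (suc (suc (suc _))) 0 2 = refl
  altCoeff₃-expand a@(suc (suc (suc _))) 0 c@(suc (suc (suc _))) = altCoeff₃-outOfRange a 0 c refl
  altCoeff₃-expand (suc (suc (suc _))) 1 0 = refl
  altCoeff₃-expand (suc (suc (suc _))) 1 1 = refl
  altCoeff₃-expand (suc (suc (suc _))) 1 2 = refl
  altCoeff₃-expand a@(suc (suc (suc _))) 1 c@(suc (suc (suc _))) = altCoeff₃-outOfRange a 1 c refl
  altCoeff₃-expand (suc (suc (suc _))) 2 0 = refl
  altCoeff₃-expand (suc (suc (suc _))) 2 1 = refl
  altCoeff₃-expand (suc (suc (suc _))) 2 2 = refl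
  altCoeff₃-expand a@(suc (suc (suc _))) 2 c@(suc (suc (suc _))) = altCoeff₃-outOfRange a 2 c refl
  altCoeff₃-expand a@(suc (suc (suc _))) b@(suc (suc (suc _))) 0 = altCoeff₃-outOfRange a b 0 refl
  altCoeff₃-expand a@(suc (suc (suc _))) b@(suc (suc (suc _))) 1 = altCoeff₃-outOfRange a b 1 refl
  altCoeff₃-expand a@(suc (suc (suc _))) b@(suc (suc (suc _))) 2 = altCoeff₃-outOfRange a b 2 refl
  altCoeff₃-expand a@(suc (suc (suc _))) b@(suc (suc (suc _))) c@(suc (suc (suc _))) = altCoeff₃-outOfRange a b c refl

  frob₃≡mulPowerSums : ∀ ks a b c → frob (a ∷ b ∷ c ∷ []) ks ≡ mulPowerSums ks altCoeff₃ a b c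
  frob₃≡mulPowerSums []       a b c = refl
  frob₃≡mulPowerSums (k ∷ ks) a b c =
    trans (frob₃-step k ks a b c) (mulPowerSum-cong k (frob₃≡mulPowerSums ks) a b c)

  frobenius₃ : ∀ ks a b c → frob (a ∷ b ∷ c ∷ []) ks ≡ mulPolynomial alternant₃ (mulPowerSums ks one) a b c
  frobenius₃ ks a b c = begin
    frob (a ∷ b ∷ c ∷ []) ks                             ≡⟨ frob₃≡mulPowerSums ks a b c ⟩
    mulPowerSums ks altCoeff₃ a b c                     ≡⟨ mulPowerSums-cong ks altCoeff₃-expand a b c ⟩
    mulPowerSums ks (mulPolynomial alternant₃ one) a b c ≡⟨ mulPowerSums-mulPolynomial ks alternant₃ one a b c ⟩
    mulPolynomial alternant₃ (mulPowerSums ks one) a b c ∎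
    where open ≡-Reasoning

  Positive : List ℕ → Set
  Positive = All (0 <_)

  alternant₂ : Polynomial
  alternant₂ = (1ℤ , 1 , 0 , 0) ∷ (-1ℤ , 0 , 1 , 0) ∷ []

  alternant₂-expand : ∀ a b → altCoeff (a ∷ b ∷ []) ≡ mulPolynomial alternant₂ one a b 0
  alternant₂-expand 0               0               = refl
  alternant₂-expand 0               1               = refl
  alternant₂-expand 0               (suc (suc b))   = refl
  alternant₂-expand 1               0               = refl
  alternant₂-expand 1               1               = refl
  alternant₂-expand 1               (suc (suc b))   = refl
  alternant₂-expand (suc (suc a))   0               = refl
  alternant₂-expand (suc (suc a))   1               = refl
  alternant₂-expand (suc (suc a))   (suc (suc b))   = altCoeff-outOfRange (suc (suc a) ∷ suc (suc b) ∷ []) refl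

  frobenius₂ : ∀ {ks} → Positive ks → ∀ a b → frob (a ∷ b ∷ []) ks ≡ mulPolynomial alternant₂ (mulPowerSums ks one) a b 0
  frobenius₂ []                           a b = alternant₂-expand a b
  frobenius₂ {suc k ∷ ks} (s≤s z≤n ∷ pos) a b = begin
    frob (a ∷ b ∷ []) (suc k ∷ ks)
      ≡⟨ sumℤ-subtractOne-∷ (λ γ → frob γ ks) (suc k) a (b ∷ []) ⟩
    X + sumℤ (map (λ γ → frob (a ∷ γ) ks) (subtractOne (suc k) (b ∷ [])))
      ≡⟨ cong (λ t → X + t) (sumℤ-subtractOne-∷ (λ γ → frob (a ∷ γ) ks) (suc k) b []) ⟩
    X + (Y + 0ℤ)
      ≡⟨ ℤ.+-assoc X Y 0ℤ ⟨
    X + Y + 0ℤ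
      ≡⟨ cong₂ (λ u v → u + v + 0ℤ) (mulX-cong (suc k) (λ a′ → frobenius₂ pos a′ b) a)
                                     (mulX-cong (suc k) (λ b′ → frobenius₂ pos a b′) b) ⟩
    mulPowerSum (suc k) (mulPolynomial alternant₂ (mulPowerSums ks one)) a b 0
      ≡⟨ mulPowerSum-mulPolynomial (suc k) alternant₂ (mulPowerSums ks one) a b 0 ⟩
    mulPolynomial alternant₂ (mulPowerSums (suc k ∷ ks) one) a b 0 ∎
    where
    open ≡-Reasoning
    X = mulX (suc k) (λ a′ → frob (a′ ∷ b ∷ []) ks) a
    Y = mulX (suc k) (λ b′ → frob (a ∷ b′ ∷ []) ks) b

  frobenius₁ : ∀ {ks} → Positive ks → ∀ a → frob (a ∷ []) ks ≡ mulPowerSums ks one a 0 0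
  frobenius₁ []                           zero    = refl
  frobenius₁ []                           (suc a) = refl
  frobenius₁ {suc k ∷ ks} (s≤s z≤n ∷ pos) a = begin
    frob (a ∷ []) (suc k ∷ ks)
      ≡⟨ sumℤ-subtractOne-∷ (λ γ → frob γ ks) (suc k) a [] ⟩
    mulX (suc k) (λ a′ → frob (a′ ∷ []) ks) a + 0ℤ
      ≡⟨ cong (λ t → t + 0ℤ) (mulX-cong (suc k) (λ a′ → frobenius₁ pos a′) a) ⟩
    mulX (suc k) (λ a′ → mulPowerSums ks one a′ 0 0) a + 0ℤ
      ≡⟨ ℤ.+-identityʳ _ ⟨
    mulPowerSums (suc k ∷ ks) one a 0 0 ∎
    where open ≡-Reasoning

  -- the coefficient of y^b z^c in ∏ₖ (1 + y^k + z^k) = p_λ(1, y, z)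
  yzCoeff : List ℕ → ℕ → ℕ → ℤ
  yzCoeff []       b c = one 0 b c
  yzCoeff (k ∷ ks) b c = yzCoeff ks b c + mulX k (λ b′ → yzCoeff ks b′ c) b + mulX k (yzCoeff ks b) c

  data Split (k : ℕ) : ℕ → Set where
    below : ∀ {a} → a < k → Split k a
    above : ∀ a → Split k (k ℕ.+ a)

  split : ∀ k a → Split k a
  split zero    a       = above a
  split (suc k) zero    = below (s≤s z≤n)
  split (suc k) (suc a) with split k a
  ... | below a<k = below (s≤s a<k)
  ... | above a′  = above a′

  yzCoeff-vanishes : ∀ ks b c → sum ks < b ℕ.+ c → yzCoeff ks b c ≡ 0ℤ
  yzCoeff-vanishes []       zero    zero    ()
  yzCoeff-vanishes []       zero    (suc c) _ = refl
  yzCoeff-vanishes []       (suc b) c       _ = refl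
  yzCoeff-vanishes (k ∷ ks) b       c       lt = begin
    yzCoeff ks b c + mulX k (λ b′ → yzCoeff ks b′ c) b + mulX k (yzCoeff ks b) c
      ≡⟨ cong₂ (λ u v → u + v + mulX k (yzCoeff ks b) c)
           (yzCoeff-vanishes ks b c (ℕ.≤-<-trans (ℕ.m≤n+m (sum ks) k) lt)) along-y ⟩
    0ℤ + 0ℤ + mulX k (yzCoeff ks b) c
      ≡⟨ cong (λ t → 0ℤ + 0ℤ + t) along-z ⟩
    0ℤ ∎
    where
    open ≡-Reasoning
    pull-z : ∀ b k c → b ℕ.+ (k ℕ.+ c) ≡ k ℕ.+ (b ℕ.+ c)
    pull-z = ℕ-solve-∀
    along-y : mulX k (λ b′ → yzCoeff ks b′ c) b ≡ 0ℤ
    along-y with split k b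
    ... | below b<k = mulX-< _ b<k
    ... | above b′  = trans (mulX-+ˡ k b′ _) (yzCoeff-vanishes ks b′ c
            (ℕ.+-cancelˡ-< k _ _ (subst (k ℕ.+ sum ks <_) (ℕ.+-assoc k b′ c) lt)))
    along-z : mulX k (yzCoeff ks b) c ≡ 0ℤ
    along-z with split k c
    ... | below c<k = mulX-< _ c<k
    ... | above c′  = trans (mulX-+ˡ k c′ _) (yzCoeff-vanishes ks b c′
            (ℕ.+-cancelˡ-< k _ _ (subst (k ℕ.+ sum ks <_) (pull-z b k c′) lt)))

  -- In p_λ every monomial has degree |λ|, so the x-exponent is determined by the other two.
  mulPowerSums-one≡yzCoeff : ∀ ks a b c → a ℕ.+ (b ℕ.+ c) ≡ sum ks → mulPowerSums ks one a b c ≡ yzCoeff ks b c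
  mulPowerSums-one≡yzCoeff []       zero    b c _  = refl
  mulPowerSums-one≡yzCoeff (k ∷ ks) a       b c eq = cong₂ _+_ (cong₂ _+_ along-x along-y) along-z
    where
    N = mulPowerSums ks one
    pull-y : ∀ k a b c → k ℕ.+ (a ℕ.+ (b ℕ.+ c)) ≡ a ℕ.+ ((k ℕ.+ b) ℕ.+ c)
    pull-y = ℕ-solve-∀
    pull-z : ∀ k a b c → k ℕ.+ (a ℕ.+ (b ℕ.+ c)) ≡ a ℕ.+ (b ℕ.+ (k ℕ.+ c))
    pull-z = ℕ-solve-∀
    along-x : mulX k (λ a′ → N a′ b c) a ≡ yzCoeff ks b c
    along-x with split k a
    ... | below a<k = trans (mulX-< _ a<k) (sym (yzCoeff-vanishes ks b c (ℕ.+-cancelˡ-< k _ _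
            (subst (ℕ._< k ℕ.+ (b ℕ.+ c)) eq (ℕ.+-monoˡ-< (b ℕ.+ c) a<k)))))
    ... | above a′  = trans (mulX-+ˡ k a′ _) (mulPowerSums-one≡yzCoeff ks a′ b c
            (ℕ.+-cancelˡ-≡ k _ _ (trans (sym (ℕ.+-assoc k a′ (b ℕ.+ c))) eq)))
    along-y : mulX k (λ b′ → N a b′ c) b ≡ mulX k (λ b′ → yzCoeff ks b′ c) b
    along-y with split k b
    ... | below b<k = trans (mulX-< _ b<k) (sym (mulX-< _ b<k))
    ... | above b′  = trans (mulX-+ˡ k b′ _) (trans (mulPowerSums-one≡yzCoeff ks a b′ c
            (ℕ.+-cancelˡ-≡ k _ _ (trans (pull-y k a b′ c) eq))) (sym (mulX-+ˡ k b′ _)))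
    along-z : mulX k (N a b) c ≡ mulX k (yzCoeff ks b) c
    along-z with split k c
    ... | below c<k = trans (mulX-< _ c<k) (sym (mulX-< _ c<k))
    ... | above c′  = trans (mulX-+ˡ k c′ _) (trans (mulPowerSums-one≡yzCoeff ks a b c′
            (ℕ.+-cancelˡ-≡ k _ _ (trans (pull-z k a b c′) eq))) (sym (mulX-+ˡ k c′ _)))

  mult : ℕ → List ℕ → ℕ
  mult k = count (ℕ._≟ k)

  private
    cong₄ : ∀ {A B C D E : Set} (f : A → B → C → D → E) {a a′ b b′ c c′ d d′} →
            a ≡ a′ → b ≡ b′ → c ≡ c′ → d ≡ d′ → f a b c d ≡ f a′ b′ c′ d′
    cong₄ f refl refl refl refl = refl

    +0+0 : ∀ x → x + 0ℤ + 0ℤ ≡ x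
    +0+0 x = trans (ℤ.+-identityʳ (x + 0ℤ)) (ℤ.+-identityʳ x)

  yzCoeff-0-0 : ∀ {ks} → Positive ks → yzCoeff ks 0 0 ≡ 1ℤ
  yzCoeff-0-0 []                         = refl
  yzCoeff-0-0 {suc _ ∷ ks} (_ ∷ pos) = trans (+0+0 _) (yzCoeff-0-0 pos)

  yzCoeff-1-0 : ∀ {ks} → Positive ks → yzCoeff ks 1 0 ≡ + mult 1 ks
  yzCoeff-1-0 []                              = refl
  yzCoeff-1-0 {1 ∷ ks} (_ ∷ pos)
    rewrite yzCoeff-1-0 pos | yzCoeff-0-0 pos = step (+ mult 1 ks)
    where step : ∀ p → p + 1ℤ + 0ℤ ≡ 1ℤ + p
          step = solve-∀
  yzCoeff-1-0 {suc (suc _) ∷ ks} (_ ∷ pos) = trans (+0+0 _) (yzCoeff-1-0 pos)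

  yzCoeff-0-1 : ∀ {ks} → Positive ks → yzCoeff ks 0 1 ≡ + mult 1 ks
  yzCoeff-0-1 []                              = refl
  yzCoeff-0-1 {1 ∷ ks} (_ ∷ pos)
    rewrite yzCoeff-0-1 pos | yzCoeff-0-0 pos = step (+ mult 1 ks)
    where step : ∀ p → p + 0ℤ + 1ℤ ≡ 1ℤ + p
          step = solve-∀
  yzCoeff-0-1 {suc (suc _) ∷ ks} (_ ∷ pos) = trans (+0+0 _) (yzCoeff-0-1 pos)

  yzCoeff-1-1 : ∀ {ks} → Positive ks → let p = + mult 1 ks in yzCoeff ks 1 1 ≡ p * (p - 1ℤ)
  yzCoeff-1-1 []                              = refl
  yzCoeff-1-1 {1 ∷ ks} (_ ∷ pos)
    rewrite yzCoeff-1-1 pos | yzCoeff-0-1 pos | yzCoeff-1-0 pos = step (+ mult 1 ks)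
    where step : ∀ p → p * (p - 1ℤ) + p + p ≡ (1ℤ + p) * (1ℤ + p - 1ℤ)
          step = solve-∀
  yzCoeff-1-1 {suc (suc _) ∷ ks} (_ ∷ pos) = trans (+0+0 _) (yzCoeff-1-1 pos)

  yzCoeff-2-0 : ∀ {ks} → Positive ks → let p = + mult 1 ks; q = + mult 2 ks in
                + 2 * yzCoeff ks 2 0 ≡ p * (p - 1ℤ) + + 2 * q
  yzCoeff-2-0 []                              = refl
  yzCoeff-2-0 {1 ∷ ks} (_ ∷ pos) = begin
    + 2 * (yzCoeff ks 2 0 + yzCoeff ks 1 0 + 0ℤ)
      ≡⟨ cong (λ y → + 2 * (yzCoeff ks 2 0 + y + 0ℤ)) (yzCoeff-1-0 pos) ⟩
    + 2 * (yzCoeff ks 2 0 + p + 0ℤ)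
      ≡⟨ step₁ (yzCoeff ks 2 0) p ⟩
    + 2 * yzCoeff ks 2 0 + + 2 * p
      ≡⟨ cong (_+ + 2 * p) (yzCoeff-2-0 pos) ⟩
    p * (p - 1ℤ) + + 2 * q + + 2 * p
      ≡⟨ step₂ p q ⟩
    (1ℤ + p) * (1ℤ + p - 1ℤ) + + 2 * q ∎
    where
    open ≡-Reasoning
    p = + mult 1 ks
    q = + mult 2 ks
    step₁ : ∀ y p → + 2 * (y + p + 0ℤ) ≡ + 2 * y + + 2 * p
    step₁ = solve-∀
    step₂ : ∀ p q → p * (p - 1ℤ) + + 2 * q + + 2 * p ≡ (1ℤ + p) * (1ℤ + p - 1ℤ) + + 2 * q
    step₂ = solve-∀
  yzCoeff-2-0 {2 ∷ ks} (_ ∷ pos) = begin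
    + 2 * (yzCoeff ks 2 0 + yzCoeff ks 0 0 + 0ℤ)
      ≡⟨ distrib (yzCoeff ks 2 0) (yzCoeff ks 0 0) ⟩
    + 2 * yzCoeff ks 2 0 + + 2 * yzCoeff ks 0 0
      ≡⟨ cong₂ (λ u v → u + + 2 * v) (yzCoeff-2-0 pos) (yzCoeff-0-0 pos) ⟩
    p * (p - 1ℤ) + + 2 * q + + 2 * 1ℤ
      ≡⟨ step p q ⟩
    p * (p - 1ℤ) + + 2 * (1ℤ + q) ∎
    where
    open ≡-Reasoning
    p = + mult 1 ks
    q = + mult 2 ks
    distrib : ∀ x y → + 2 * (x + y + 0ℤ) ≡ + 2 * x + + 2 * y
    distrib = solve-∀
    step : ∀ p q → p * (p - 1ℤ) + + 2 * q + + 2 * 1ℤ ≡ p * (p - 1ℤ) + + 2 * (1ℤ + q)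
    step = solve-∀
  yzCoeff-2-0 {suc (suc (suc _)) ∷ ks} (_ ∷ pos) = trans (cong (+ 2 *_) (+0+0 _)) (yzCoeff-2-0 pos)

  yzCoeff-3-0 : ∀ {ks} → Positive ks → let p = + mult 1 ks; q = + mult 2 ks; r = + mult 3 ks in
                + 6 * yzCoeff ks 3 0 ≡ p * (p - 1ℤ) * (p - + 2) + + 6 * p * q + + 6 * r
  yzCoeff-3-0 [] = refl
  yzCoeff-3-0 {1 ∷ ks} (_ ∷ pos) = begin
    + 6 * (yzCoeff ks 3 0 + yzCoeff ks 2 0 + 0ℤ)
      ≡⟨ distrib (yzCoeff ks 3 0) (yzCoeff ks 2 0) ⟩
    + 6 * yzCoeff ks 3 0 + + 3 * (+ 2 * yzCoeff ks 2 0)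
      ≡⟨ cong₂ (λ u v → u + + 3 * v) (yzCoeff-3-0 pos) (yzCoeff-2-0 pos) ⟩
    p * (p - 1ℤ) * (p - + 2) + + 6 * p * q + + 6 * r + + 3 * (p * (p - 1ℤ) + + 2 * q)
      ≡⟨ step p q r ⟩
    (1ℤ + p) * (1ℤ + p - 1ℤ) * (1ℤ + p - + 2) + + 6 * (1ℤ + p) * q + + 6 * r ∎
    where
    open ≡-Reasoning
    p = + mult 1 ks
    q = + mult 2 ks
    r = + mult 3 ks
    distrib : ∀ x y → + 6 * (x + y + 0ℤ) ≡ + 6 * x + + 3 * (+ 2 * y)
    distrib = solve-∀
    step : ∀ p q r → p * (p - 1ℤ) * (p - + 2) + + 6 * p * q + + 6 * r + + 3 * (p * (p - 1ℤ) + + 2 * q)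
                     ≡ (1ℤ + p) * (1ℤ + p - 1ℤ) * (1ℤ + p - + 2) + + 6 * (1ℤ + p) * q + + 6 * r
    step = solve-∀
  yzCoeff-3-0 {2 ∷ ks} (_ ∷ pos) = begin
    + 6 * (yzCoeff ks 3 0 + yzCoeff ks 1 0 + 0ℤ)
      ≡⟨ distrib (yzCoeff ks 3 0) (yzCoeff ks 1 0) ⟩
    + 6 * yzCoeff ks 3 0 + + 6 * yzCoeff ks 1 0
      ≡⟨ cong₂ (λ u v → u + + 6 * v) (yzCoeff-3-0 pos) (yzCoeff-1-0 pos) ⟩
    p * (p - 1ℤ) * (p - + 2) + + 6 * p * q + + 6 * r + + 6 * p
      ≡⟨ step p q r ⟩
    p * (p - 1ℤ) * (p - + 2) + + 6 * p * (1ℤ + q) + + 6 * r ∎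
    where
    open ≡-Reasoning
    p = + mult 1 ks
    q = + mult 2 ks
    r = + mult 3 ks
    distrib : ∀ x y → + 6 * (x + y + 0ℤ) ≡ + 6 * x + + 6 * y
    distrib = solve-∀
    step : ∀ p q r → p * (p - 1ℤ) * (p - + 2) + + 6 * p * q + + 6 * r + + 6 * p
                     ≡ p * (p - 1ℤ) * (p - + 2) + + 6 * p * (1ℤ + q) + + 6 * r
    step = solve-∀
  yzCoeff-3-0 {3 ∷ ks} (_ ∷ pos) = begin
    + 6 * (yzCoeff ks 3 0 + yzCoeff ks 0 0 + 0ℤ)
      ≡⟨ distrib (yzCoeff ks 3 0) (yzCoeff ks 0 0) ⟩
    + 6 * yzCoeff ks 3 0 + + 6 * yzCoeff ks 0 0
      ≡⟨ cong₂ (λ u v → u + + 6 * v) (yzCoeff-3-0 pos) (yzCoeff-0-0 pos) ⟩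
    p * (p - 1ℤ) * (p - + 2) + + 6 * p * q + + 6 * r + + 6 * 1ℤ
      ≡⟨ step p q r ⟩
    p * (p - 1ℤ) * (p - + 2) + + 6 * p * q + + 6 * (1ℤ + r) ∎
    where
    open ≡-Reasoning
    p = + mult 1 ks
    q = + mult 2 ks
    r = + mult 3 ks
    distrib : ∀ x y → + 6 * (x + y + 0ℤ) ≡ + 6 * x + + 6 * y
    distrib = solve-∀
    step : ∀ p q r → p * (p - 1ℤ) * (p - + 2) + + 6 * p * q + + 6 * r + + 6 * 1ℤ
                     ≡ p * (p - 1ℤ) * (p - + 2) + + 6 * p * q + + 6 * (1ℤ + r)
    step = solve-∀
  yzCoeff-3-0 {suc (suc (suc (suc _))) ∷ ks} (_ ∷ pos) = trans (cong (+ 6 *_) (+0+0 _)) (yzCoeff-3-0 pos)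

  yzCoeff-2-1 : ∀ {ks} → Positive ks → let p = + mult 1 ks; q = + mult 2 ks in
                + 2 * yzCoeff ks 2 1 ≡ p * (p - 1ℤ) * (p - + 2) + + 2 * p * q
  yzCoeff-2-1 [] = refl
  yzCoeff-2-1 {1 ∷ ks} (_ ∷ pos) = begin
    + 2 * (yzCoeff ks 2 1 + yzCoeff ks 1 1 + yzCoeff ks 2 0)
      ≡⟨ distrib (yzCoeff ks 2 1) (yzCoeff ks 1 1) (yzCoeff ks 2 0) ⟩
    + 2 * yzCoeff ks 2 1 + + 2 * yzCoeff ks 1 1 + + 2 * yzCoeff ks 2 0
      ≡⟨ cong₂ _+_ (cong₂ (λ u v → u + + 2 * v) (yzCoeff-2-1 pos) (yzCoeff-1-1 pos)) (yzCoeff-2-0 pos) ⟩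
    p * (p - 1ℤ) * (p - + 2) + + 2 * p * q + + 2 * (p * (p - 1ℤ)) + (p * (p - 1ℤ) + + 2 * q)
      ≡⟨ step p q ⟩
    (1ℤ + p) * (1ℤ + p - 1ℤ) * (1ℤ + p - + 2) + + 2 * (1ℤ + p) * q ∎
    where
    open ≡-Reasoning
    p = + mult 1 ks
    q = + mult 2 ks
    distrib : ∀ x y z → + 2 * (x + y + z) ≡ + 2 * x + + 2 * y + + 2 * z
    distrib = solve-∀
    step : ∀ p q → p * (p - 1ℤ) * (p - + 2) + + 2 * p * q + + 2 * (p * (p - 1ℤ)) + (p * (p - 1ℤ) + + 2 * q)
                   ≡ (1ℤ + p) * (1ℤ + p - 1ℤ) * (1ℤ + p - + 2) + + 2 * (1ℤ + p) * q
    step = solve-∀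
  yzCoeff-2-1 {2 ∷ ks} (_ ∷ pos) = begin
    + 2 * (yzCoeff ks 2 1 + yzCoeff ks 0 1 + 0ℤ)
      ≡⟨ distrib (yzCoeff ks 2 1) (yzCoeff ks 0 1) ⟩
    + 2 * yzCoeff ks 2 1 + + 2 * yzCoeff ks 0 1
      ≡⟨ cong₂ (λ u v → u + + 2 * v) (yzCoeff-2-1 pos) (yzCoeff-0-1 pos) ⟩
    p * (p - 1ℤ) * (p - + 2) + + 2 * p * q + + 2 * p
      ≡⟨ step p q ⟩
    p * (p - 1ℤ) * (p - + 2) + + 2 * p * (1ℤ + q) ∎
    where
    open ≡-Reasoning
    p = + mult 1 ks
    q = + mult 2 ks
    distrib : ∀ x y → + 2 * (x + y + 0ℤ) ≡ + 2 * x + + 2 * y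
    distrib = solve-∀
    step : ∀ p q → p * (p - 1ℤ) * (p - + 2) + + 2 * p * q + + 2 * p ≡ p * (p - 1ℤ) * (p - + 2) + + 2 * p * (1ℤ + q)
    step = solve-∀
  yzCoeff-2-1 {suc (suc (suc _)) ∷ ks} (_ ∷ pos) = trans (cong (+ 2 *_) (+0+0 _)) (yzCoeff-2-1 pos)

  mulPowerSums-one≡yzCoeff′ : ∀ ks a b c → sum ks ≡ (b ℕ.+ c) ℕ.+ a → mulPowerSums ks one a b c ≡ yzCoeff ks b c
  mulPowerSums-one≡yzCoeff′ ks a b c hs = mulPowerSums-one≡yzCoeff ks a b c (trans (ℕ.+-comm a (b ℕ.+ c)) (sym hs))

  χ[a] : ∀ {ks} a → Positive ks → sum ks ≡ a → χ (a ∷ []) ks ≡ 1ℤ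
  χ[a] {ks} a pos hs = begin
    frob (a ℕ.+ 0 ∷ []) ks             ≡⟨ frobenius₁ pos (a ℕ.+ 0) ⟩
    mulPowerSums ks one (a ℕ.+ 0) 0 0  ≡⟨ mulPowerSums-one≡yzCoeff′ ks (a ℕ.+ 0) 0 0 (trans hs (sym (ℕ.+-identityʳ a))) ⟩
    yzCoeff ks 0 0                     ≡⟨ yzCoeff-0-0 pos ⟩
    1ℤ                                 ∎
    where open ≡-Reasoning

  χ[a,1] : ∀ {ks} a → Positive ks → sum ks ≡ 1 ℕ.+ a → χ (a ∷ 1 ∷ []) ks ≡ + mult 1 ks - 1ℤ
  χ[a,1] {ks} a pos hs = begin
    frob (a ℕ.+ 1 ∷ 1 ∷ []) ks
      ≡⟨ cong (λ t → frob (t ∷ 1 ∷ []) ks) (ℕ.+-comm a 1) ⟩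
    frob (suc a ∷ 1 ∷ []) ks
      ≡⟨ frobenius₂ pos (suc a) 1 ⟩
    1ℤ * N a 1 0 + (-1ℤ * N (suc a) 0 0 + 0ℤ)
      ≡⟨ cong₂ (λ u v → 1ℤ * u + (-1ℤ * v + 0ℤ)) (N≡Y a 1 0 hs) (N≡Y (suc a) 0 0 hs) ⟩
    1ℤ * yzCoeff ks 1 0 + (-1ℤ * yzCoeff ks 0 0 + 0ℤ)
      ≡⟨ cong₂ (λ u v → 1ℤ * u + (-1ℤ * v + 0ℤ)) (yzCoeff-1-0 pos) (yzCoeff-0-0 pos) ⟩
    1ℤ * p + (-1ℤ * 1ℤ + 0ℤ)
      ≡⟨ simplify p ⟩
    p - 1ℤ ∎
    where
    open ≡-Reasoning
    N = mulPowerSums ks one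
    N≡Y = mulPowerSums-one≡yzCoeff′ ks
    p = + mult 1 ks
    simplify : ∀ p → 1ℤ * p + (-1ℤ * 1ℤ + 0ℤ) ≡ p - 1ℤ
    simplify = solve-∀

  χ[a,2] : ∀ {ks} a → Positive ks → sum ks ≡ 2 ℕ.+ a → let p = + mult 1 ks; q = + mult 2 ks in
           + 2 * χ (a ∷ 2 ∷ []) ks ≡ (p - 1ℤ) * (p - + 2) + + 2 * (q - 1ℤ)
  χ[a,2] {ks} a pos hs = begin
    + 2 * frob (a ℕ.+ 1 ∷ 2 ∷ []) ks
      ≡⟨ cong (λ t → + 2 * frob (t ∷ 2 ∷ []) ks) (ℕ.+-comm a 1) ⟩
    + 2 * frob (suc a ∷ 2 ∷ []) ks
      ≡⟨ cong (+ 2 *_) (frobenius₂ pos (suc a) 2) ⟩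
    + 2 * (1ℤ * N a 2 0 + (-1ℤ * N (suc a) 1 0 + 0ℤ))
      ≡⟨ cong₂ (λ u v → + 2 * (1ℤ * u + (-1ℤ * v + 0ℤ))) (N≡Y a 2 0 hs) (N≡Y (suc a) 1 0 hs) ⟩
    + 2 * (1ℤ * yzCoeff ks 2 0 + (-1ℤ * yzCoeff ks 1 0 + 0ℤ))
      ≡⟨ distrib (yzCoeff ks 2 0) (yzCoeff ks 1 0) ⟩
    + 2 * yzCoeff ks 2 0 - + 2 * yzCoeff ks 1 0
      ≡⟨ cong₂ (λ u v → u - + 2 * v) (yzCoeff-2-0 pos) (yzCoeff-1-0 pos) ⟩
    p * (p - 1ℤ) + + 2 * q - + 2 * p
      ≡⟨ simplify p q ⟩
    (p - 1ℤ) * (p - + 2) + + 2 * (q - 1ℤ) ∎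
    where
    open ≡-Reasoning
    N = mulPowerSums ks one
    N≡Y = mulPowerSums-one≡yzCoeff′ ks
    p = + mult 1 ks
    q = + mult 2 ks
    distrib : ∀ x y → + 2 * (1ℤ * x + (-1ℤ * y + 0ℤ)) ≡ + 2 * x - + 2 * y
    distrib = solve-∀
    simplify : ∀ p q → p * (p - 1ℤ) + + 2 * q - + 2 * p ≡ (p - 1ℤ) * (p - + 2) + + 2 * (q - 1ℤ)
    simplify = solve-∀

  χ[a,1,1] : ∀ {ks} a → Positive ks → sum ks ≡ 2 ℕ.+ a → let p = + mult 1 ks; q = + mult 2 ks in
             + 2 * χ (a ∷ 1 ∷ 1 ∷ []) ks ≡ (p - 1ℤ) * (p - + 2) - + 2 * q
  χ[a,1,1] {ks} a pos hs = begin
    + 2 * frob (a ℕ.+ 2 ∷ 2 ∷ 1 ∷ []) ks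
      ≡⟨ cong (λ t → + 2 * frob (t ∷ 2 ∷ 1 ∷ []) ks) (ℕ.+-comm a 2) ⟩
    + 2 * frob (2 ℕ.+ a ∷ 2 ∷ 1 ∷ []) ks
      ≡⟨ cong (+ 2 *_) (frobenius₃ ks (2 ℕ.+ a) 2 1) ⟩
    + 2 * terms (N a 1 1) (N a 2 0) (N (1 ℕ.+ a) 0 1) (N (2 ℕ.+ a) 0 0)
      ≡⟨ cong₄ (λ w x y z → + 2 * terms w x y z)
           (N≡Y a 1 1 hs) (N≡Y a 2 0 hs) (N≡Y (1 ℕ.+ a) 0 1 hs) (N≡Y (2 ℕ.+ a) 0 0 hs) ⟩
    + 2 * terms (Y 1 1) (Y 2 0) (Y 0 1) (Y 0 0)
      ≡⟨ distrib (Y 1 1) (Y 2 0) (Y 0 1) (Y 0 0) ⟩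
    + 2 * Y 1 1 - + 2 * Y 2 0 - + 2 * Y 0 1 + + 2 * Y 0 0
      ≡⟨ cong₄ (λ w x y z → + 2 * w - x - + 2 * y + + 2 * z)
           (yzCoeff-1-1 pos) (yzCoeff-2-0 pos) (yzCoeff-0-1 pos) (yzCoeff-0-0 pos) ⟩
    + 2 * (p * (p - 1ℤ)) - (p * (p - 1ℤ) + + 2 * q) - + 2 * p + + 2 * 1ℤ
      ≡⟨ simplify p q ⟩
    (p - 1ℤ) * (p - + 2) - + 2 * q ∎
    where
    open ≡-Reasoning
    N = mulPowerSums ks one
    N≡Y = mulPowerSums-one≡yzCoeff′ ks
    Y = yzCoeff ks
    p = + mult 1 ks
    q = + mult 2 ks
    terms : ℤ → ℤ → ℤ → ℤ → ℤ
    terms w x y z = 1ℤ * w + (-1ℤ * x + (-1ℤ * y + (0ℤ + (1ℤ * z + (0ℤ + 0ℤ)))))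
    distrib : ∀ w x y z → + 2 * (1ℤ * w + (-1ℤ * x + (-1ℤ * y + (0ℤ + (1ℤ * z + (0ℤ + 0ℤ))))))
                          ≡ + 2 * w - + 2 * x - + 2 * y + + 2 * z
    distrib = solve-∀
    simplify : ∀ p q → + 2 * (p * (p - 1ℤ)) - (p * (p - 1ℤ) + + 2 * q) - + 2 * p + + 2 * 1ℤ
                       ≡ (p - 1ℤ) * (p - + 2) - + 2 * q
    simplify = solve-∀

  χ[a,2,1] : ∀ {ks} a → Positive ks → sum ks ≡ 3 ℕ.+ a → let p = + mult 1 ks; r = + mult 3 ks in
             + 3 * χ (a ∷ 2 ∷ 1 ∷ []) ks ≡ (p - 1ℤ) * (p - + 2) * (p - + 3) - + 3 * (p + r - + 2)
  χ[a,2,1] {ks} a pos hs = ℤ.*-cancelˡ-≡ (+ 2) _ _ (begin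
    + 2 * (+ 3 * frob (a ℕ.+ 2 ∷ 3 ∷ 1 ∷ []) ks)
      ≡⟨ cong (λ t → + 2 * (+ 3 * frob (t ∷ 3 ∷ 1 ∷ []) ks)) (ℕ.+-comm a 2) ⟩
    + 2 * (+ 3 * frob (2 ℕ.+ a ∷ 3 ∷ 1 ∷ []) ks)
      ≡⟨ cong (λ t → + 2 * (+ 3 * t)) (frobenius₃ ks (2 ℕ.+ a) 3 1) ⟩
    + 2 * (+ 3 * terms (N a 2 1) (N a 3 0) (N (1 ℕ.+ a) 1 1) (N (2 ℕ.+ a) 1 0))
      ≡⟨ cong₄ (λ w x y z → + 2 * (+ 3 * terms w x y z))
           (N≡Y a 2 1 hs) (N≡Y a 3 0 hs) (N≡Y (1 ℕ.+ a) 1 1 hs) (N≡Y (2 ℕ.+ a) 1 0 hs) ⟩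
    + 2 * (+ 3 * terms (Y 2 1) (Y 3 0) (Y 1 1) (Y 1 0))
      ≡⟨ distrib (Y 2 1) (Y 3 0) (Y 1 1) (Y 1 0) ⟩
    + 3 * (+ 2 * Y 2 1) - + 6 * Y 3 0 - + 6 * Y 1 1 + + 6 * Y 1 0
      ≡⟨ cong₄ (λ w x y z → + 3 * w - x - + 6 * y + + 6 * z)
           (yzCoeff-2-1 pos) (yzCoeff-3-0 pos) (yzCoeff-1-1 pos) (yzCoeff-1-0 pos) ⟩
    + 3 * (p * (p - 1ℤ) * (p - + 2) + + 2 * p * q) - (p * (p - 1ℤ) * (p - + 2) + + 6 * p * q + + 6 * r)
      - + 6 * (p * (p - 1ℤ)) + + 6 * p
      ≡⟨ simplify p q r ⟩
    + 2 * ((p - 1ℤ) * (p - + 2) * (p - + 3) - + 3 * (p + r - + 2)) ∎)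
    where
    open ≡-Reasoning
    N = mulPowerSums ks one
    N≡Y = mulPowerSums-one≡yzCoeff′ ks
    Y = yzCoeff ks
    p = + mult 1 ks
    q = + mult 2 ks
    r = + mult 3 ks
    terms : ℤ → ℤ → ℤ → ℤ → ℤ
    terms w x y z = 1ℤ * w + (-1ℤ * x + (-1ℤ * y + (0ℤ + (1ℤ * z + (0ℤ + 0ℤ)))))
    distrib : ∀ w x y z → + 2 * (+ 3 * (1ℤ * w + (-1ℤ * x + (-1ℤ * y + (0ℤ + (1ℤ * z + (0ℤ + 0ℤ)))))))
                          ≡ + 3 * (+ 2 * w) - + 6 * x - + 6 * y + + 6 * z
    distrib = solve-∀
    simplify : ∀ p q r → + 3 * (p * (p - 1ℤ) * (p - + 2) + + 2 * p * q) - (p * (p - 1ℤ) * (p - + 2) + + 6 * p * q + + 6 * r)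
                         - + 6 * (p * (p - 1ℤ)) + + 6 * p
                         ≡ + 2 * ((p - 1ℤ) * (p - + 2) * (p - + 3) - + 3 * (p + r - + 2))
    simplify = solve-∀

  χ-sum : ∀ {ks} m → Positive ks → sum ks ≡ 3 ℕ.+ m → let p = + mult 1 ks; r = + mult 3 ks in
          + 6 * (χ (2 ℕ.+ m ∷ 1 ∷ []) ks + χ (1 ℕ.+ m ∷ 2 ∷ []) ks + χ (1 ℕ.+ m ∷ 1 ∷ 1 ∷ []) ks + χ (m ∷ 2 ∷ 1 ∷ []) ks)
          ≡ + 2 * (p * (p - 1ℤ) * (p - + 2)) - + 6 * r
  χ-sum {ks} m pos hs = begin
    + 6 * (A + B + C + D)
      ≡⟨ distrib A B C D ⟩
    + 6 * A + + 3 * (+ 2 * B) + + 3 * (+ 2 * C) + + 2 * (+ 3 * D)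
      ≡⟨ cong₄ (λ a b c d → + 6 * a + + 3 * b + + 3 * c + + 2 * d)
           (χ[a,1] (2 ℕ.+ m) pos hs) (χ[a,2] (1 ℕ.+ m) pos hs) (χ[a,1,1] (1 ℕ.+ m) pos hs) (χ[a,2,1] m pos hs) ⟩
    + 6 * (p - 1ℤ) + + 3 * ((p - 1ℤ) * (p - + 2) + + 2 * (q - 1ℤ)) + + 3 * ((p - 1ℤ) * (p - + 2) - + 2 * q)
      + + 2 * ((p - 1ℤ) * (p - + 2) * (p - + 3) - + 3 * (p + r - + 2))
      ≡⟨ simplify p q r ⟩
    + 2 * (p * (p - 1ℤ) * (p - + 2)) - + 6 * r ∎
    where
    open ≡-Reasoning
    A = χ (2 ℕ.+ m ∷ 1 ∷ []) ks
    B = χ (1 ℕ.+ m ∷ 2 ∷ []) ks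
    C = χ (1 ℕ.+ m ∷ 1 ∷ 1 ∷ []) ks
    D = χ (m ∷ 2 ∷ 1 ∷ []) ks
    p = + mult 1 ks
    q = + mult 2 ks
    r = + mult 3 ks
    distrib : ∀ a b c d → + 6 * (a + b + c + d) ≡ + 6 * a + + 3 * (+ 2 * b) + + 3 * (+ 2 * c) + + 2 * (+ 3 * d)
    distrib = solve-∀
    simplify : ∀ p q r → + 6 * (p - 1ℤ) + + 3 * ((p - 1ℤ) * (p - + 2) + + 2 * (q - 1ℤ)) + + 3 * ((p - 1ℤ) * (p - + 2) - + 2 * q)
                         + + 2 * ((p - 1ℤ) * (p - + 2) * (p - + 3) - + 3 * (p + r - + 2))
                         ≡ + 2 * (p * (p - 1ℤ) * (p - + 2)) - + 6 * r
    simplify = solve-∀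

module WindowIdentity where

  open import Data.Bool using (Bool; true; false; if_then_else_; _∧_)
  open import Data.Empty using (⊥-elim)
  open import Data.Fin as Fin using (Fin; toℕ)
  import Data.Fin.Properties as Fin
  open import Data.List using (List; []; _∷_; length; filter)
  import Data.List.Properties as List
  open import Data.List.Membership.Propositional using (_∈_)
  open import Data.List.Membership.Propositional.Properties using (∈-filter⁺; ∈-filter⁻)
  open import Data.List.Relation.Unary.Any using (here; there)
  open import Data.Nat as ℕ using (ℕ; suc; _+_; _*_; _<ᵇ_; _≡ᵇ_; _≤_; _<_; z≤n; s≤s)
  import Data.Nat.Properties as ℕ
  open import Algebra.Properties.CommutativeSemigroup ℕ.+-commutativeSemigroup using () renaming (interchange to +-interchange)
  open import Data.Product using (_×_; _,_; proj₂)
  open import Data.Sum using (_⊎_; inj₁; inj₂)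
  open import Function using (_∘_; _⟨_⟩_)
  open import Relation.Binary.Definitions using (tri<; tri≈; tri>)
  open import Relation.Binary.PropositionalEquality
  open import Relation.Nullary using (Dec; yes; no; ¬_)
  open import Relation.Nullary.Decidable using (dec-true; dec-false; toWitness; _→-dec_; _×-dec_; _⊎-dec_; ¬?)

  𝟙 : Bool → ℕ
  𝟙 true  = 1
  𝟙 false = 0

  peakℕ : ℕ → ℕ → ℕ → ℕ
  peakℕ u v w = if (u <ᵇ v) ∧ (w <ᵇ v) then 1 else 0

  peakℕ-cong : ∀ {a b c a′ b′ c′} → a ≡ a′ → b ≡ b′ → c ≡ c′ → peakℕ a b c ≡ peakℕ a′ b′ c′
  peakℕ-cong refl refl refl = refl

  swapℕ : ℕ → ℕ → ℕ → ℕ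
  swapℕ s t x = if x ≡ᵇ s then t else if x ≡ᵇ t then s else x

  τ₀₁ τ₁₂ τ₀₂ : ℕ → ℕ → ℕ
  τ₀₁ X = swapℕ X (1 + X)
  τ₁₂ X = swapℕ (1 + X) (2 + X)
  τ₀₂ X = swapℕ X (2 + X)

  -- If π takes the values U, V, W at the positions X, X+1, X+2, then σπσ⁻¹ takes at these positions
  -- the values listed below, for the six permutations σ of {X, X+1, X+2}; τᵢⱼ swaps X+i and X+j.
  conjugatePeaks : ℕ → ℕ → ℕ → ℕ → ℕ
  conjugatePeaks X U V W =
    peakℕ U V W + peakℕ (τ₀₁ X V) (τ₀₁ X U) (τ₀₁ X W) + peakℕ (τ₁₂ X U) (τ₁₂ X W) (τ₁₂ X V)
    + peakℕ (τ₀₂ X W) (τ₀₂ X V) (τ₀₂ X U) + peakℕ (τ₀₁ X (τ₁₂ X W)) (τ₀₁ X (τ₁₂ X U)) (τ₀₁ X (τ₁₂ X V))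
    + peakℕ (τ₁₂ X (τ₀₁ X V)) (τ₁₂ X (τ₀₁ X W)) (τ₁₂ X (τ₀₁ X U))

  window-lhs window-rhs : ℕ → ℕ → ℕ → ℕ → ℕ
  window-lhs X U V W = conjugatePeaks X U V W + 2 * (𝟙 (U ≡ᵇ X) * 𝟙 (V ≡ᵇ 1 + X) * 𝟙 (W ≡ᵇ 2 + X))
  window-rhs X U V W = 2 + 𝟙 (U ≡ᵇ 1 + X) * 𝟙 (V ≡ᵇ 2 + X) * 𝟙 (W ≡ᵇ X) + 𝟙 (U ≡ᵇ 2 + X) * 𝟙 (W ≡ᵇ 1 + X) * 𝟙 (V ≡ᵇ X)

  Distinctℕ : ℕ → ℕ → ℕ → Set
  Distinctℕ u v w = u ≢ v × u ≢ w × v ≢ w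

  distinctℕ? : ∀ u v w → Dec (Distinctℕ u v w)
  distinctℕ? u v w = ¬? (u ℕ.≟ v) ×-dec ¬? (u ℕ.≟ w) ×-dec ¬? (v ℕ.≟ w)

  window-identity-small : ∀ (u v w : Fin 7) (x : Fin 4) → let U = toℕ u; V = toℕ v; W = toℕ w; X = toℕ x in
                          Distinctℕ U V W → window-lhs X U V W ≡ window-rhs X U V W
  window-identity-small = toWitness {a? = Fin.all? λ u → Fin.all? λ v → Fin.all? λ w → Fin.all? λ x →
    distinctℕ? (toℕ u) (toℕ v) (toℕ w) →-dec
    (window-lhs (toℕ x) (toℕ u) (toℕ v) (toℕ w) ℕ.≟ window-rhs (toℕ x) (toℕ u) (toℕ v) (toℕ w))} _

  <ᵇ-true : ∀ {s t} → s < t → (s <ᵇ t) ≡ true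
  <ᵇ-true {s} {t} = dec-true (s ℕ.<? t)

  <ᵇ-false : ∀ {s t} → ¬ s < t → (s <ᵇ t) ≡ false
  <ᵇ-false {s} {t} = dec-false (s ℕ.<? t)

  ≡ᵇ-true : ∀ {s t} → s ≡ t → (s ≡ᵇ t) ≡ true
  ≡ᵇ-true {s} {t} = dec-true (s ℕ.≟ t)

  ≡ᵇ-false : ∀ {s t} → s ≢ t → (s ≡ᵇ t) ≡ false
  ≡ᵇ-false {s} {t} = dec-false (s ℕ.≟ t)

  rank : List ℕ → ℕ → ℕ
  rank []       t = 0
  rank (s ∷ ss) t = 𝟙 (s <ᵇ t) + rank ss t

  occurrences : List ℕ → ℕ → ℕ
  occurrences []       t = 0
  occurrences (s ∷ ss) t = 𝟙 (s ≡ᵇ t) + occurrences ss t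

  𝟙-<ᵇ-mono : ∀ s {t t′} → t ≤ t′ → 𝟙 (s <ᵇ t) ≤ 𝟙 (s <ᵇ t′)
  𝟙-<ᵇ-mono s {t} {t′} t≤t′ with s ℕ.<? t
  ... | yes s<t rewrite <ᵇ-true s<t | <ᵇ-true (ℕ.<-≤-trans s<t t≤t′) = ℕ.≤-refl
  ... | no  s≮t rewrite <ᵇ-false s≮t = z≤n

  𝟙-<ᵇ-suc : ∀ s t → 𝟙 (s <ᵇ suc t) ≡ 𝟙 (s <ᵇ t) + 𝟙 (s ≡ᵇ t)
  𝟙-<ᵇ-suc s t with ℕ.<-cmp s t
  ... | tri< s<t s≢t _ rewrite <ᵇ-true s<t | <ᵇ-true (ℕ.m<n⇒m<1+n s<t) | ≡ᵇ-false s≢t = refl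
  ... | tri≈ _ refl _  rewrite <ᵇ-false (ℕ.<-irrefl {s} refl) | <ᵇ-true (ℕ.n<1+n s) | ≡ᵇ-true {s} refl = refl
  ... | tri> s≮t s≢t t<s rewrite <ᵇ-false s≮t | ≡ᵇ-false s≢t | <ᵇ-false (ℕ.<⇒≱ t<s ∘ ℕ.≤-pred) = refl

  rank-mono : ∀ L {t t′} → t ≤ t′ → rank L t ≤ rank L t′
  rank-mono []       t≤t′ = z≤n
  rank-mono (s ∷ ss) t≤t′ = ℕ.+-mono-≤ (𝟙-<ᵇ-mono s t≤t′) (rank-mono ss t≤t′)

  rank-strict : ∀ {L s t} → s ∈ L → s < t → rank L s < rank L t
  rank-strict {s ∷ ss} {t = t} (here refl) s<t rewrite <ᵇ-false (ℕ.<-irrefl {s} refl) | <ᵇ-true s<t =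
    s≤s (rank-mono ss (ℕ.<⇒≤ s<t))
  rank-strict {s′ ∷ ss} (there s∈) s<t = ℕ.+-mono-≤-< (𝟙-<ᵇ-mono s′ (ℕ.<⇒≤ s<t)) (rank-strict s∈ s<t)

  rank-suc : ∀ L t → rank L (suc t) ≡ rank L t + occurrences L t
  rank-suc []       t = refl
  rank-suc (s ∷ ss) t rewrite 𝟙-<ᵇ-suc s t | rank-suc ss t = +-interchange (𝟙 (s <ᵇ t)) (𝟙 (s ≡ᵇ t)) _ _

  rank-≤ : ∀ L t → rank L t ≤ length L
  rank-≤ []       t = z≤n
  rank-≤ (s ∷ ss) t = ℕ.+-mono-≤ (𝟙≤1 (s <ᵇ t)) (rank-≤ ss t)
    where 𝟙≤1 : ∀ b → 𝟙 b ≤ 1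
          𝟙≤1 true  = ℕ.≤-refl
          𝟙≤1 false = z≤n

  module _ {L : List ℕ} {s t : ℕ} (s∈L : s ∈ L) (t∈L : t ∈ L) where

    rank-<ᵇ : (rank L s <ᵇ rank L t) ≡ (s <ᵇ t)
    rank-<ᵇ with ℕ.<-cmp s t
    ... | tri< s<t _ _   rewrite <ᵇ-true s<t | <ᵇ-true (rank-strict s∈L s<t) = refl
    ... | tri≈ s≮t refl _ rewrite <ᵇ-false s≮t | <ᵇ-false (ℕ.<-irrefl {rank L s} refl) = refl
    ... | tri> s≮t _ t<s rewrite <ᵇ-false s≮t | <ᵇ-false (ℕ.<⇒≯ (rank-strict t∈L t<s)) = refl

    rank-≡ᵇ : (rank L s ≡ᵇ rank L t) ≡ (s ≡ᵇ t)
    rank-≡ᵇ with ℕ.<-cmp s t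
    ... | tri< s<t s≢t _ rewrite ≡ᵇ-false s≢t | ≡ᵇ-false (ℕ.<⇒≢ (rank-strict s∈L s<t)) = refl
    ... | tri≈ _ refl _  rewrite ≡ᵇ-true {s} refl | ≡ᵇ-true {rank L s} refl = refl
    ... | tri> _ s≢t t<s rewrite ≡ᵇ-false s≢t | ≡ᵇ-false (ℕ.<⇒≢ (rank-strict t∈L t<s) ∘ sym) = refl

    rank-injective : rank L s ≡ rank L t → s ≡ t
    rank-injective eq with ℕ.<-cmp s t
    ... | tri< s<t _ _ = ⊥-elim (ℕ.<⇒≢ (rank-strict s∈L s<t) eq)
    ... | tri≈ _ s≡t _ = s≡t
    ... | tri> _ _ t<s = ⊥-elim (ℕ.<⇒≢ (rank-strict t∈L t<s) (sym eq))

  module _ {L : List ℕ} where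

    swap-∈ : ∀ {a b t} → a ∈ L → b ∈ L → t ∈ L → swapℕ a b t ∈ L
    swap-∈ {a} {b} {t} a∈L b∈L t∈L with t ≡ᵇ a
    ... | true  = b∈L
    ... | false with t ≡ᵇ b
    ...   | true  = a∈L
    ...   | false = t∈L

    rank-swap : ∀ {a b t} → a ∈ L → b ∈ L → t ∈ L → rank L (swapℕ a b t) ≡ swapℕ (rank L a) (rank L b) (rank L t)
    rank-swap {a} {b} {t} a∈L b∈L t∈L rewrite rank-≡ᵇ t∈L a∈L | rank-≡ᵇ t∈L b∈L with t ≡ᵇ a
    ... | true  = refl
    ... | false with t ≡ᵇ b
    ...   | true  = refl
    ...   | false = refl

    rank-peak : ∀ {a b c} → a ∈ L → b ∈ L → c ∈ L → peakℕ (rank L a) (rank L b) (rank L c) ≡ peakℕ a b c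
    rank-peak a∈L b∈L c∈L rewrite rank-<ᵇ a∈L b∈L | rank-<ᵇ c∈L b∈L = refl

    rank-𝟙≡ᵇ : ∀ {a b} → a ∈ L → b ∈ L → 𝟙 (rank L a ≡ᵇ rank L b) ≡ 𝟙 (a ≡ᵇ b)
    rank-𝟙≡ᵇ a∈L b∈L = cong 𝟙 (rank-≡ᵇ a∈L b∈L)

  occurrences-absent : ∀ {L t} → (∀ {s} → s ∈ L → s ≢ t) → occurrences L t ≡ 0
  occurrences-absent {[]}     absent = refl
  occurrences-absent {s ∷ ss} absent rewrite ≡ᵇ-false (absent (here refl)) = occurrences-absent (absent ∘ there)

  -- Ranking the values U, V, W together with the window X, X+1, X+2 (values of U, V, W inside the
  -- window are not counted twice) keeps the window consecutive and bounds everything by 6.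
  module Compress (X U V W : ℕ) where

    outside? : ∀ e → Dec (e < X ⊎ 2 + X < e)
    outside? e = e ℕ.<? X ⊎-dec (2 + X) ℕ.<? e

    L : List ℕ
    L = X ∷ 1 + X ∷ 2 + X ∷ filter outside? (U ∷ V ∷ W ∷ [])

    ρ : ℕ → ℕ
    ρ = rank L

    window-∈ : ∀ {e} → e ≡ X ⊎ e ≡ 1 + X ⊎ e ≡ 2 + X → e ∈ L
    window-∈ (inj₁ refl)        = here refl
    window-∈ (inj₂ (inj₁ refl)) = there (here refl)
    window-∈ (inj₂ (inj₂ refl)) = there (there (here refl))

    inside : ∀ {e} → ¬ (e < X ⊎ 2 + X < e) → e ≡ X ⊎ e ≡ 1 + X ⊎ e ≡ 2 + X
    inside {e} out with ℕ.<-cmp e (1 + X)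
    ... | tri< e<1+X _ _ = inj₁ (ℕ.≤-antisym (ℕ.≤-pred e<1+X) (ℕ.≮⇒≥ (out ∘ inj₁)))
    ... | tri≈ _ e≡1+X _ = inj₂ (inj₁ e≡1+X)
    ... | tri> _ _ 1+X<e = inj₂ (inj₂ (ℕ.≤-antisym (ℕ.≮⇒≥ (out ∘ inj₂)) 1+X<e))

    value-∈ : ∀ {e} → e ∈ U ∷ V ∷ W ∷ [] → e ∈ L
    value-∈ {e} e∈UVW with outside? e
    ... | yes out = there (there (there (∈-filter⁺ outside? e∈UVW out)))
    ... | no  ¬out = window-∈ (inside ¬out)

    X∈ : X ∈ L
    X∈ = here refl
    X₁∈ : 1 + X ∈ L
    X₁∈ = there (here refl)
    X₂∈ : 2 + X ∈ L
    X₂∈ = there (there (here refl))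
    U∈ : U ∈ L
    U∈ = value-∈ (here refl)
    V∈ : V ∈ L
    V∈ = value-∈ (there (here refl))
    W∈ : W ∈ L
    W∈ = value-∈ (there (there (here refl)))

    private
      outside-∉ : ∀ {s t} → s ∈ filter outside? (U ∷ V ∷ W ∷ []) → t ≡ X ⊎ t ≡ 1 + X → s ≢ t
      outside-∉ s∈ t∈ refl with proj₂ (∈-filter⁻ outside? s∈) | t∈
      ... | inj₁ s<X   | inj₁ refl = ℕ.<-irrefl refl s<X
      ... | inj₁ s<X   | inj₂ refl = ℕ.<-asym s<X (ℕ.n<1+n X)
      ... | inj₂ 2+X<s | inj₁ refl = ℕ.<-asym 2+X<s (ℕ.<-trans (ℕ.n<1+n X) (ℕ.n<1+n (1 + X)))
      ... | inj₂ 2+X<s | inj₂ refl = ℕ.<-asym 2+X<s (ℕ.n<1+n (1 + X))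

    ρ-X₁ : ρ (1 + X) ≡ 1 + ρ X
    ρ-X₁ = begin
      rank L (suc X)                ≡⟨ rank-suc L X ⟩
      ρ X + occurrences L X         ≡⟨ cong (ρ X +_) once ⟩
      ρ X + 1                       ≡⟨ ℕ.+-comm (ρ X) 1 ⟩
      1 + ρ X                       ∎
      where
      open ≡-Reasoning
      once : occurrences L X ≡ 1
      once rewrite ≡ᵇ-true {X} refl | ≡ᵇ-false (ℕ.1+n≢n {X}) | ≡ᵇ-false (ℕ.<⇒≢ (ℕ.m<n+m X {2} (s≤s z≤n)) ∘ sym)
                 | occurrences-absent (λ s∈ → outside-∉ s∈ (inj₁ refl)) = refl

    ρ-X₂ : ρ (2 + X) ≡ 2 + ρ X
    ρ-X₂ = begin
      rank L (suc (suc X))          ≡⟨ rank-suc L (suc X) ⟩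
      ρ (1 + X) + occurrences L (1 + X) ≡⟨ cong₂ _+_ ρ-X₁ once ⟩
      1 + ρ X + 1                   ≡⟨ ℕ.+-comm (1 + ρ X) 1 ⟩
      2 + ρ X                       ∎
      where
      open ≡-Reasoning
      once : occurrences L (1 + X) ≡ 1
      once rewrite ≡ᵇ-false (ℕ.1+n≢n {X} ∘ sym) | ≡ᵇ-true {1 + X} refl | ≡ᵇ-false (ℕ.1+n≢n {1 + X})
                 | occurrences-absent (λ s∈ → outside-∉ s∈ (inj₂ refl)) = refl

    ρ-X≤3 : ρ X ≤ 3
    ρ-X≤3 rewrite <ᵇ-false (ℕ.<-irrefl {X} refl) | <ᵇ-false (ℕ.<-asym (ℕ.n<1+n X))
                | <ᵇ-false (ℕ.<-asym (ℕ.<-trans (ℕ.n<1+n X) (ℕ.n<1+n (1 + X))))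
      = ℕ.≤-trans (rank-≤ (filter outside? (U ∷ V ∷ W ∷ [])) X) (List.length-filter outside? (U ∷ V ∷ W ∷ []))

    ρ≤6 : ∀ t → ρ t ≤ 6
    ρ≤6 t = ℕ.≤-trans (rank-≤ L t) (s≤s (s≤s (s≤s (List.length-filter outside? (U ∷ V ∷ W ∷ [])))))

    record Transfers (f g : ℕ → ℕ) : Set where
      field transfer : ∀ {t} → t ∈ L → f t ∈ L × ρ (f t) ≡ g (ρ t)
    open Transfers

    transfers-id : Transfers (λ t → t) (λ t → t)
    transfer transfers-id t∈L = t∈L , refl

    transfers-∘ : ∀ {f g f′ g′} → Transfers f g → Transfers f′ g′ → Transfers (f ∘ f′) (g ∘ g′)
    transfer (transfers-∘ {g = g} f~g f′~g′) t∈L with transfer f′~g′ t∈L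
    ... | f′t∈L , eq′ with transfer f~g f′t∈L
    ...   | ft∈L , eq = ft∈L , trans eq (cong g eq′)

    transfers-swap : ∀ {a b} → a ∈ L → b ∈ L → ∀ {a′ b′} → ρ a ≡ a′ → ρ b ≡ b′ → Transfers (swapℕ a b) (swapℕ a′ b′)
    transfer (transfers-swap a∈L b∈L refl refl) t∈L = swap-∈ a∈L b∈L t∈L , rank-swap a∈L b∈L t∈L

    transfers-τ₀₁ : Transfers (τ₀₁ X) (τ₀₁ (ρ X))
    transfers-τ₀₁ = transfers-swap X∈ X₁∈ refl ρ-X₁
    transfers-τ₁₂ : Transfers (τ₁₂ X) (τ₁₂ (ρ X))
    transfers-τ₁₂ = transfers-swap X₁∈ X₂∈ ρ-X₁ ρ-X₂
    transfers-τ₀₂ : Transfers (τ₀₂ X) (τ₀₂ (ρ X))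
    transfers-τ₀₂ = transfers-swap X∈ X₂∈ refl ρ-X₂

    peak-transfer : ∀ {f g} → Transfers f g → ∀ {a b c} → a ∈ L → b ∈ L → c ∈ L →
                    peakℕ (f a) (f b) (f c) ≡ peakℕ (g (ρ a)) (g (ρ b)) (g (ρ c))
    peak-transfer {f} {g} f~g {a} {b} {c} a∈L b∈L c∈L with transfer f~g a∈L | transfer f~g b∈L | transfer f~g c∈L
    ... | fa∈L , ρfa | fb∈L , ρfb | fc∈L , ρfc =
      trans (sym (rank-peak fa∈L fb∈L fc∈L)) (peakℕ-cong ρfa ρfb ρfc)

    indicator-transfer : ∀ {a b b′} → a ∈ L → b ∈ L → ρ b ≡ b′ → 𝟙 (a ≡ᵇ b) ≡ 𝟙 (ρ a ≡ᵇ b′)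
    indicator-transfer a∈L b∈L refl = sym (rank-𝟙≡ᵇ a∈L b∈L)

    window-lhs-compress : window-lhs X U V W ≡ window-lhs (ρ X) (ρ U) (ρ V) (ρ W)
    window-lhs-compress = cong₂ _+_
      (cong₂ _+_ (cong₂ _+_ (cong₂ _+_ (cong₂ _+_ (cong₂ _+_
        (peak-transfer transfers-id U∈ V∈ W∈)
        (peak-transfer transfers-τ₀₁ V∈ U∈ W∈))
        (peak-transfer transfers-τ₁₂ U∈ W∈ V∈))
        (peak-transfer transfers-τ₀₂ W∈ V∈ U∈))
        (peak-transfer (transfers-∘ transfers-τ₀₁ transfers-τ₁₂) W∈ U∈ V∈))
        (peak-transfer (transfers-∘ transfers-τ₁₂ transfers-τ₀₁) V∈ W∈ U∈))
      (cong (2 *_) (cong₂ _*_ (cong₂ _*_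
        (indicator-transfer U∈ X∈ refl) (indicator-transfer V∈ X₁∈ ρ-X₁)) (indicator-transfer W∈ X₂∈ ρ-X₂)))

    window-rhs-compress : window-rhs X U V W ≡ window-rhs (ρ X) (ρ U) (ρ V) (ρ W)
    window-rhs-compress = cong₂ _+_
      (cong (2 +_) (cong₂ _*_ (cong₂ _*_
        (indicator-transfer U∈ X₁∈ ρ-X₁) (indicator-transfer V∈ X₂∈ ρ-X₂)) (indicator-transfer W∈ X∈ refl)))
      (cong₂ _*_ (cong₂ _*_
        (indicator-transfer U∈ X₂∈ ρ-X₂) (indicator-transfer W∈ X₁∈ ρ-X₁)) (indicator-transfer V∈ X∈ refl))

    distinct-compress : Distinctℕ U V W → Distinctℕ (ρ U) (ρ V) (ρ W)
    distinct-compress (U≢V , U≢W , V≢W) =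
      U≢V ∘ rank-injective U∈ V∈ , U≢W ∘ rank-injective U∈ W∈ , V≢W ∘ rank-injective V∈ W∈

  window-identity-bounded : ∀ {u v w x} → u ≤ 6 → v ≤ 6 → w ≤ 6 → x ≤ 3 → Distinctℕ u v w → window-lhs x u v w ≡ window-rhs x u v w
  window-identity-bounded {u} {v} {w} {x} u≤6 v≤6 w≤6 x≤3 =
    subst (λ (u , v , w , x) → Distinctℕ u v w → window-lhs x u v w ≡ window-rhs x u v w) values (window-identity-small u′ v′ w′ x′)
    where
    u′ = Fin.fromℕ< (s≤s u≤6)
    v′ = Fin.fromℕ< (s≤s v≤6)
    w′ = Fin.fromℕ< (s≤s w≤6)
    x′ = Fin.fromℕ< (s≤s x≤3)
    values : (toℕ u′ , toℕ v′ , toℕ w′ , toℕ x′) ≡ (u , v , w , x)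
    values rewrite Fin.toℕ-fromℕ< (s≤s u≤6) | Fin.toℕ-fromℕ< (s≤s v≤6)
                 | Fin.toℕ-fromℕ< (s≤s w≤6) | Fin.toℕ-fromℕ< (s≤s x≤3) = refl

  window-identity : ∀ X {U V W} → Distinctℕ U V W → window-lhs X U V W ≡ window-rhs X U V W
  window-identity X {U} {V} {W} distinct = begin
    window-lhs X U V W                  ≡⟨ window-lhs-compress ⟩
    window-lhs (ρ X) (ρ U) (ρ V) (ρ W)  ≡⟨ window-identity-bounded (ρ≤6 U) (ρ≤6 V) (ρ≤6 W) ρ-X≤3 (distinct-compress distinct) ⟩
    window-rhs (ρ X) (ρ U) (ρ V) (ρ W)  ≡⟨ window-rhs-compress ⟨
    window-rhs X U V W                  ∎
    where
    open ≡-Reasoning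
    open Compress X U V W

module PeakSums where

  import Data.Nat.Properties as ℕ
  open import Algebra.Properties.CommutativeSemigroup ℕ.+-commutativeSemigroup using () renaming (interchange to +-interchange)
  open import Algebra.Properties.Semiring.Sum ℕ.+-*-semiring
    using (sum-syntax; sum-cong-≗; sum-replicate-zero; ∑-distrib-+; ∑-permute; *-distribˡ-sum; *-distribʳ-sum)
    renaming (sum to ∑)
  open import Data.Bool using (Bool; true; false; if_then_else_; not; _∧_)
  open import Data.Empty using (⊥; ⊥-elim)
  open import Data.Fin as Fin using (Fin; zero; suc; toℕ)
  open import Data.Fin.Permutation using () renaming (transpose to transposition)
  open import Data.Fin.Permutation.Components using (transpose)
  import Data.Fin.Properties as Fin
  open import Data.List as List using (List; []; _∷_; map; filter; length; allFin; upTo)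
  import Data.List.Properties as List
  open import Data.List.Membership.Propositional using (_∈_)
  open import Data.List.Membership.Propositional.Properties using (∈-map⁺; ∈-map⁻)
  open import Data.List.Membership.Propositional.Properties.WithK using (unique∧set⇒bag)
  open import Data.List.Relation.Binary.BagAndSetEquality using (∼bag⇒↭)
  open import Data.List.Relation.Binary.Permutation.Propositional using (_↭_)
  import Data.List.Relation.Binary.Permutation.Propositional.Properties as ↭
  import Data.List.Relation.Unary.All as All
  open import Data.List.Relation.Unary.All using ([]; _∷_)
  import Data.List.Relation.Unary.All.Properties as AllP
  open import Data.List.Relation.Unary.Unique.Propositional using (Unique)
  import Data.List.Relation.Unary.Unique.Propositional.Properties as Unique
  open import Data.Nat as ℕ using (ℕ; zero; suc; _+_; _*_; _∸_)
  open import Data.Nat.ListAction using (sum)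
  open import Data.Nat.ListAction.Properties using (sum-↭)
  open import Data.Nat.Tactic.RingSolver using () renaming (solve-∀ to ℕ-solve-∀)
  open import Data.Product using (_×_; _,_; proj₁)
  open import Data.Sum using (_⊎_; inj₁; inj₂)
  open import Data.Vec as Vec using (Vec; lookup; tabulate)
  import Data.Vec.Properties as Vec
  open import Function using (_∘_; _⇔_; Equivalence; mk⇔; _⟨_⟩_)
  open import Relation.Binary.PropositionalEquality
  open import Relation.Nullary using (Dec; yes; no; does; ¬_)
  open import Relation.Nullary.Decidable using (dec-true; dec-false)
  open import Relation.Unary using (Decidable)
  open Characters using (mult)
  open WindowIdentity

  private variable n : ℕ

  count-tabulate : ∀ {A : Set} {P : A → Set} (P? : Decidable P) (f : Fin n → A) →
                   length (filter P? (List.tabulate f)) ≡ ∑[ i < n ] 𝟙 (does (P? (f i)))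
  count-tabulate {zero}  P? f = refl
  count-tabulate {suc n} P? f with does (P? (f zero))
  ... | true  = cong suc (count-tabulate P? (f ∘ suc))
  ... | false = count-tabulate P? (f ∘ suc)

  count-allFin : ∀ {P : Fin n → Set} (P? : Decidable P) → length (filter P? (allFin n)) ≡ ∑[ i < n ] 𝟙 (does (P? i))
  count-allFin P? = count-tabulate P? (λ i → i)

  ∑-const : ∀ n k → ∑[ i < n ] k ≡ n * k
  ∑-const zero    k = refl
  ∑-const (suc n) k = cong (k +_) (∑-const n k)

  δ : Fin n → Fin n → ℕ
  δ i j = 𝟙 (does (i Fin.≟ j))

  δ̸ : Fin n → Fin n → ℕ
  δ̸ i j = 𝟙 (not (does (i Fin.≟ j)))

  ∑-δ : ∀ (g : Fin n → ℕ) a → ∑[ c < n ] (δ a c * g c) ≡ g a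
  ∑-δ {suc n} g zero    = trans (cong (g zero + 0 +_) (sum-replicate-zero n)) (trans (ℕ.+-identityʳ _) (ℕ.+-identityʳ _))
  ∑-δ {suc n} g (suc a) = ∑-δ (g ∘ suc) a

  ∑-δ̸ : ∀ (g : Fin n → ℕ) a → ∑[ c < n ] (δ̸ a c * g c) + g a ≡ ∑[ c < n ] g c
  ∑-δ̸ {suc n} g zero    = trans (cong (_+ g zero) (sum-cong-≗ (λ c → ℕ.+-identityʳ (g (suc c)))))
                                  (ℕ.+-comm (∑[ c < n ] g (suc c)) (g zero))
  ∑-δ̸ {suc n} g (suc a) = begin
    g zero + 0 + ∑[ c < n ] (δ̸ a c * g (suc c)) + g (suc a)
      ≡⟨ cong (λ t → t + ∑[ c < n ] (δ̸ a c * g (suc c)) + g (suc a)) (ℕ.+-identityʳ (g zero)) ⟩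
    g zero + ∑[ c < n ] (δ̸ a c * g (suc c)) + g (suc a)
      ≡⟨ ℕ.+-assoc (g zero) _ (g (suc a)) ⟩
    g zero + (∑[ c < n ] (δ̸ a c * g (suc c)) + g (suc a))
      ≡⟨ cong (g zero +_) (∑-δ̸ (g ∘ suc) a) ⟩
    g zero + ∑[ c < n ] g (suc c) ∎
    where open ≡-Reasoning

  𝟙-∧ : ∀ x y → 𝟙 (x ∧ y) ≡ 𝟙 x * 𝟙 y
  𝟙-∧ true  y = sym (ℕ.+-identityʳ (𝟙 y))
  𝟙-∧ false y = refl

  δ̸-≢ : ∀ {a b : Fin n} → a ≢ b → δ̸ a b ≡ 1
  δ̸-≢ {a = a} {b} a≢b rewrite dec-false (a Fin.≟ b) a≢b = refl

  sum-map-+ : ∀ {A : Set} (f g : A → ℕ) xs → sum (map (λ x → f x + g x) xs) ≡ sum (map f xs) + sum (map g xs)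
  sum-map-+ f g []       = refl
  sum-map-+ f g (x ∷ xs) = trans (cong (f x + g x +_) (sum-map-+ f g xs)) (+-interchange (f x) (g x) _ _)

  sum-map-* : ∀ {A : Set} k (f : A → ℕ) xs → sum (map (λ x → k * f x) xs) ≡ k * sum (map f xs)
  sum-map-* k f []       = sym (ℕ.*-zeroʳ k)
  sum-map-* k f (x ∷ xs) = trans (cong (k * f x +_) (sum-map-* k f xs)) (sym (ℕ.*-distribˡ-+ k (f x) _))

  sum-map-const : ∀ {A : Set} k (xs : List A) → sum (map (λ _ → k) xs) ≡ length xs * k
  sum-map-const k []       = refl
  sum-map-const k (x ∷ xs) = cong (k +_) (sum-map-const k xs)

  sum-map-cong : ∀ {A : Set} {f g : A → ℕ} {xs} → (∀ {x} → x ∈ xs → f x ≡ g x) → sum (map f xs) ≡ sum (map g xs)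
  sum-map-cong f≗g = cong sum (List.map-cong-local (All.tabulate f≗g))

  sum-map-∑ : ∀ {A : Set} (f : A → Fin n → ℕ) xs → sum (map (λ x → ∑[ i < n ] f x i) xs) ≡ ∑[ i < n ] sum (map (λ x → f x i) xs)
  sum-map-∑ {n} f []       = sym (sum-replicate-zero n)
  sum-map-∑     f (x ∷ xs) = trans (cong (∑ (f x) +_) (sum-map-∑ f xs)) (sym (∑-distrib-+ (f x) _))

  transpose-matchˡ : ∀ (i j : Fin n) → transpose i j i ≡ j
  transpose-matchˡ i j rewrite dec-true (i Fin.≟ i) refl = refl

  transpose-matchʳ : ∀ (i j : Fin n) → transpose i j j ≡ i
  transpose-matchʳ i j with j Fin.≟ i
  ... | yes j≡i = j≡i
  ... | no  j≢i rewrite dec-true (j Fin.≟ j) refl = refl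

  transpose-fix : ∀ {i j k : Fin n} → k ≢ i → k ≢ j → transpose i j k ≡ k
  transpose-fix {i = i} {j} {k} k≢i k≢j rewrite dec-false (k Fin.≟ i) k≢i | dec-false (k Fin.≟ j) k≢j = refl

  transpose-involutive : ∀ (i j k : Fin n) → transpose i j (transpose i j k) ≡ k
  transpose-involutive i j k with k Fin.≟ i
  ... | yes refl = transpose-matchʳ k j
  ... | no  k≢i with k Fin.≟ j
  ...   | yes refl = transpose-matchˡ i k
  ...   | no  k≢j  = transpose-fix k≢i k≢j

  transpose-injective : ∀ (i j : Fin n) {k l} → transpose i j k ≡ transpose i j l → k ≡ l
  transpose-injective i j {k} {l} eq =
    trans (sym (transpose-involutive i j k)) (trans (cong (transpose i j) eq) (transpose-involutive i j l))

  transpose-≢ : ∀ (i j : Fin n) {k l} → k ≢ l → transpose i j k ≢ transpose i j l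
  transpose-≢ i j k≢l eq = k≢l (transpose-injective i j eq)

  does-transpose : ∀ (i j k l : Fin n) → does (transpose i j k Fin.≟ l) ≡ does (k Fin.≟ transpose i j l)
  does-transpose i j k l with transpose i j k Fin.≟ l | k Fin.≟ transpose i j l
  ... | yes _  | yes _  = refl
  ... | no  _  | no  _  = refl
  ... | yes eq | no  ne = ⊥-elim (ne (trans (sym (transpose-involutive i j k)) (cong (transpose i j) eq)))
  ... | no  ne | yes eq = ⊥-elim (ne (trans (cong (transpose i j) eq) (transpose-involutive i j l)))

  ∑-transpose : ∀ (i j : Fin n) (f : Fin n → ℕ) → ∑[ k < n ] f (transpose i j k) ≡ ∑[ k < n ] f k
  ∑-transpose i j f = sym (∑-permute f (transposition i j))

  conj : Fin n → Fin n → Perm n → Perm n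
  conj i j π = tabulate (λ k → transpose i j (lookup π (transpose i j k)))

  lookup-conj : ∀ (i j : Fin n) π k → lookup (conj i j π) k ≡ transpose i j (lookup π (transpose i j k))
  lookup-conj i j π = Vec.lookup∘tabulate _

  conj-involutive : ∀ (i j : Fin n) π → conj i j (conj i j π) ≡ π
  conj-involutive i j π = trans (Vec.tabulate-cong twice) (Vec.tabulate∘lookup π)
    where
    twice : ∀ k → transpose i j (lookup (conj i j π) (transpose i j k)) ≡ lookup π k
    twice k rewrite lookup-conj i j π (transpose i j k)
                  | transpose-involutive i j k
                  | transpose-involutive i j (lookup π k) = refl

  conj-injective : ∀ (i j : Fin n) {π ρ} → conj i j π ≡ conj i j ρ → π ≡ ρ
  conj-injective i j {π} {ρ} eq =
    trans (sym (conj-involutive i j π)) (trans (cong (conj i j) eq) (conj-involutive i j ρ))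

  conj-isPerm : ∀ (i j : Fin n) {π} → IsPerm π → IsPerm (conj i j π)
  conj-isPerm i j {π} π-inj k l eq = transpose-injective i j (π-inj _ _ (transpose-injective i j
    (trans (sym (lookup-conj i j π k)) (trans eq (lookup-conj i j π l)))))

  iter-conj : ∀ (i j : Fin n) π t k → iter (conj i j π) t k ≡ transpose i j (iter π t (transpose i j k))
  iter-conj i j π zero    k = sym (transpose-involutive i j k)
  iter-conj i j π (suc t) k rewrite iter-conj i j π t k
                                  | lookup-conj i j π (transpose i j (iter π t (transpose i j k)))
                                  | transpose-involutive i j (iter π t (transpose i j k)) = refl

  first-cong : ∀ {p q : ℕ → Bool} → (∀ t → p t ≡ q t) → ∀ ts → first p ts ≡ first q ts
  first-cong p≗q []       = refl
  first-cong {q = q} p≗q (t ∷ ts) rewrite p≗q t with q t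
  ... | true  = refl
  ... | false = first-cong p≗q ts

  orbitLen-conj : ∀ (i j : Fin n) π k → orbitLen (conj i j π) k ≡ orbitLen π (transpose i j k)
  orbitLen-conj {n} i j π k = first-cong returns (map suc (upTo n))
    where
    returns : ∀ t → does (iter (conj i j π) t k Fin.≟ k) ≡ does (iter π t (transpose i j k) Fin.≟ transpose i j k)
    returns t rewrite iter-conj i j π t k = does-transpose i j (iter π t (transpose i j k)) k

  conj-hasCycleType : ∀ (i j : Fin n) {π λp} → HasCycleType π λp → HasCycleType (conj i j π) λp
  conj-hasCycleType {n} i j {π} {λp} type ℓ = begin
    ℓ * count (ℕ._≟ ℓ) λp
      ≡⟨ type ℓ ⟩
    length (filter (λ k → orbitLen π k ℕ.≟ ℓ) (allFin n))
      ≡⟨ count-allFin (λ k → orbitLen π k ℕ.≟ ℓ) ⟩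
    ∑[ k < n ] 𝟙 (does (orbitLen π k ℕ.≟ ℓ))
      ≡⟨ ∑-transpose i j (λ k → 𝟙 (does (orbitLen π k ℕ.≟ ℓ))) ⟨
    ∑[ k < n ] 𝟙 (does (orbitLen π (transpose i j k) ℕ.≟ ℓ))
      ≡⟨ sum-cong-≗ (λ k → cong (λ o → 𝟙 (does (o ℕ.≟ ℓ))) (orbitLen-conj i j π k)) ⟨
    ∑[ k < n ] 𝟙 (does (orbitLen (conj i j π) k ℕ.≟ ℓ))
      ≡⟨ count-allFin (λ k → orbitLen (conj i j π) k ℕ.≟ ℓ) ⟨
    length (filter (λ k → orbitLen (conj i j π) k ℕ.≟ ℓ) (allFin n)) ∎
    where open ≡-Reasoning

  IsConjugacyClass : List ℕ → List (Perm n) → Set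
  IsConjugacyClass {n} λp C = ∀ (π : Perm n) → (π ∈ C) ⇔ (IsPerm π × HasCycleType π λp)

  module ClassSums {λp : List ℕ} {C : List (Perm n)} (C-unique : Unique C) (C-class : IsConjugacyClass λp C) where

    conj-∈ : ∀ (i j : Fin n) {π} → π ∈ C → conj i j π ∈ C
    conj-∈ i j {π} π∈C with Equivalence.to (C-class π) π∈C
    ... | π-perm , π-type =
      Equivalence.from (C-class (conj i j π)) (conj-isPerm i j {π} π-perm , conj-hasCycleType i j {π} {λp} π-type)

    members : ∀ {π} → π ∈ C → IsPerm π × HasCycleType π λp
    members {π} = Equivalence.to (C-class π)

    map-conj-↭ : ∀ (i j : Fin n) → map (conj i j) C ↭ C
    map-conj-↭ i j = ∼bag⇒↭ (unique∧set⇒bag (Unique.map⁺ (conj-injective i j) C-unique) C-unique (mk⇔ into onto))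
      where
      into : ∀ {π} → π ∈ map (conj i j) C → π ∈ C
      into π∈ with ∈-map⁻ (conj i j) π∈
      ... | ρ , ρ∈C , refl = conj-∈ i j ρ∈C
      onto : ∀ {π} → π ∈ C → π ∈ map (conj i j) C
      onto {π} π∈C = subst (_∈ map (conj i j) C) (conj-involutive i j π) (∈-map⁺ (conj i j) (conj-∈ i j π∈C))

    sum-conj : ∀ (i j : Fin n) (h : Perm n → ℕ) → sum (map (h ∘ conj i j) C) ≡ sum (map h C)
    sum-conj i j h = trans (cong sum (List.map-∘ C)) (sum-↭ (↭.map⁺ h (map-conj-↭ i j)))

  Distinct : Fin n → Fin n → Fin n → Set
  Distinct a b c = a ≢ b × a ≢ c × b ≢ c

  distinct? : Fin n → Fin n → Fin n → Bool
  distinct? a b c = not (does (a Fin.≟ b)) ∧ not (does (a Fin.≟ c)) ∧ not (does (b Fin.≟ c))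

  data DistinctView {n} (a b c : Fin n) : Bool → Set where
    all-distinct : Distinct a b c → DistinctView a b c true
    repeated     : ¬ Distinct a b c → DistinctView a b c false

  distinctView : ∀ (a b c : Fin n) → DistinctView a b c (distinct? a b c)
  distinctView a b c with a Fin.≟ b | a Fin.≟ c | b Fin.≟ c
  ... | yes a≡b | _       | _       = repeated λ (a≢b , _ , _) → a≢b a≡b
  ... | no  _   | yes a≡c | _       = repeated λ (_ , a≢c , _) → a≢c a≡c
  ... | no  _   | no  _   | yes b≡c = repeated λ (_ , _ , b≢c) → b≢c b≡c
  ... | no  a≢b | no  a≢c | no  b≢c = all-distinct (a≢b , a≢c , b≢c)

  ∑≠ : (Fin n → Fin n → Fin n → ℕ) → ℕ
  ∑≠ {n} g = ∑[ a < n ] ∑[ b < n ] ∑[ c < n ] (𝟙 (distinct? a b c) * g a b c)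

  ∑≠-cong : ∀ {g h : Fin n → Fin n → Fin n → ℕ} → (∀ {a b c} → Distinct a b c → g a b c ≡ h a b c) → ∑≠ g ≡ ∑≠ h
  ∑≠-cong {n} {g} {h} g≗h = sum-cong-≗ (λ a → sum-cong-≗ (λ b → sum-cong-≗ (λ c → on-distinct a b c)))
    where
    on-distinct : ∀ a b c → 𝟙 (distinct? a b c) * g a b c ≡ 𝟙 (distinct? a b c) * h a b c
    on-distinct a b c with distinct? a b c | distinctView a b c
    ... | true  | all-distinct abc = cong (_+ 0) (g≗h abc)
    ... | false | repeated _       = refl

  ∑≠-*ʳ : ∀ (g : Fin n → Fin n → Fin n → ℕ) K → ∑≠ (λ a b c → g a b c * K) ≡ ∑≠ g * K
  ∑≠-*ʳ {n} g K = begin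
    ∑[ a < n ] ∑[ b < n ] ∑[ c < n ] (𝟙 (distinct? a b c) * (g a b c * K))
      ≡⟨ sum-cong-≗ (λ a → trans
           (sum-cong-≗ (λ b → trans (sum-cong-≗ (λ c → sym (ℕ.*-assoc (𝟙 (distinct? a b c)) (g a b c) K)))
                                     (sym (*-distribʳ-sum K (λ c → 𝟙 (distinct? a b c) * g a b c)))))
           (sym (*-distribʳ-sum K (λ b → ∑[ c < n ] (𝟙 (distinct? a b c) * g a b c))))) ⟩
    ∑[ a < n ] (∑[ b < n ] ∑[ c < n ] (𝟙 (distinct? a b c) * g a b c) * K)
      ≡⟨ sym (*-distribʳ-sum K (λ a → ∑[ b < n ] ∑[ c < n ] (𝟙 (distinct? a b c) * g a b c))) ⟩
    ∑≠ g * K ∎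
    where open ≡-Reasoning

  sum-map-∑≠ : ∀ {A : Set} (G : A → Fin n → Fin n → Fin n → ℕ) xs →
               sum (map (λ x → ∑≠ (G x)) xs) ≡ ∑≠ (λ a b c → sum (map (λ x → G x a b c) xs))
  sum-map-∑≠ {n} G xs = begin
    sum (map (λ x → ∑[ a < n ] ∑[ b < n ] ∑[ c < n ] (𝟙 (distinct? a b c) * G x a b c)) xs)
      ≡⟨ sum-map-∑ (λ x a → ∑[ b < n ] ∑[ c < n ] (𝟙 (distinct? a b c) * G x a b c)) xs ⟩
    ∑[ a < n ] sum (map (λ x → ∑[ b < n ] ∑[ c < n ] (𝟙 (distinct? a b c) * G x a b c)) xs)
      ≡⟨ sum-cong-≗ (λ a → trans (sum-map-∑ (λ x b → ∑[ c < n ] (𝟙 (distinct? a b c) * G x a b c)) xs)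
           (sum-cong-≗ (λ b → trans (sum-map-∑ (λ x c → 𝟙 (distinct? a b c) * G x a b c) xs)
             (sum-cong-≗ (λ c → sum-map-* (𝟙 (distinct? a b c)) (λ x → G x a b c) xs))))) ⟩
    ∑≠ (λ a b c → sum (map (λ x → G x a b c) xs)) ∎
    where open ≡-Reasoning

  ∑≠-subset : ∀ (P : Fin n → Bool) → let k = ∑[ a < n ] 𝟙 (P a) in
              ∑≠ (λ a b c → 𝟙 (P a) * 𝟙 (P b) * 𝟙 (P c)) ≡ k * (k ∸ 1) * (k ∸ 2)
  ∑≠-subset {n} P = begin
    ∑[ a < n ] ∑[ b < n ] ∑[ c < n ] (𝟙 (distinct? a b c) * (f a * f b * f c))
      ≡⟨ sum-cong-≗ (λ a → sum-cong-≗ (λ b → sum-cong-≗ (λ c → regroup a b c))) ⟩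
    ∑[ a < n ] ∑[ b < n ] ∑[ c < n ] (f a * (δ̸ a b * f b * (δ̸ a c * (δ̸ b c * f c))))
      ≡⟨ sum-cong-≗ (λ a → trans (sum-cong-≗ (λ b → sym (*-distribˡ-sum (f a) (λ c → δ̸ a b * f b * (δ̸ a c * (δ̸ b c * f c))))))
                                  (sym (*-distribˡ-sum (f a) (λ b → ∑[ c < n ] (δ̸ a b * f b * (δ̸ a c * (δ̸ b c * f c))))))) ⟩
    ∑[ a < n ] (f a * ∑[ b < n ] ∑[ c < n ] (δ̸ a b * f b * (δ̸ a c * (δ̸ b c * f c))))
      ≡⟨ sum-cong-≗ (λ a → per-point a) ⟩
    ∑[ a < n ] (f a * ((k ∸ 1) * (k ∸ 2)))
      ≡⟨ sym (*-distribʳ-sum ((k ∸ 1) * (k ∸ 2)) f) ⟩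
    k * ((k ∸ 1) * (k ∸ 2))
      ≡⟨ ℕ.*-assoc k (k ∸ 1) (k ∸ 2) ⟨
    k * (k ∸ 1) * (k ∸ 2) ∎
    where
    open ≡-Reasoning
    f : Fin n → ℕ
    f a = 𝟙 (P a)
    k = ∑[ a < n ] f a
    regroup : ∀ a b c → 𝟙 (distinct? a b c) * (f a * f b * f c) ≡ f a * (δ̸ a b * f b * (δ̸ a c * (δ̸ b c * f c)))
    regroup a b c rewrite 𝟙-∧ (not (does (a Fin.≟ b))) (not (does (a Fin.≟ c)) ∧ not (does (b Fin.≟ c)))
                        | 𝟙-∧ (not (does (a Fin.≟ c))) (not (does (b Fin.≟ c)))
      = shuffle (δ̸ a b) (δ̸ a c) (δ̸ b c) (f a) (f b) (f c)
      where shuffle : ∀ ab ac bc fa fb fc → ab * (ac * bc) * (fa * fb * fc) ≡ fa * (ab * fb * (ac * (bc * fc)))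
            shuffle = ℕ-solve-∀
    others₁ : ∀ a → P a ≡ true → ∑[ b < n ] (δ̸ a b * f b) ≡ k ∸ 1
    others₁ a Pa = sym (trans (cong (_∸ 1) (sym (∑-δ̸ f a))) (cong (λ t → ∑[ b < n ] (δ̸ a b * f b) + t ∸ 1) (cong 𝟙 Pa)
                     ⟨ trans ⟩ ℕ.m+n∸n≡m _ 1))
    others₂ : ∀ a b → P a ≡ true → P b ≡ true → a ≢ b → ∑[ c < n ] (δ̸ a c * (δ̸ b c * f c)) ≡ k ∸ 2
    others₂ a b Pa Pb a≢b = begin
      X          ≡⟨ ℕ.m+n∸n≡m X 2 ⟨
      X + 2 ∸ 2  ≡⟨ cong (_∸ 2) two-more ⟩
      k ∸ 2      ∎
      where
      X = ∑[ c < n ] (δ̸ a c * (δ̸ b c * f c))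
      a-term : δ̸ b a * f a ≡ 1
      a-term rewrite δ̸-≢ (a≢b ∘ sym) | Pa = refl
      two-more : X + 2 ≡ k
      two-more = begin
        X + 2                     ≡⟨ ℕ.+-assoc X 1 1 ⟨
        X + 1 + 1                 ≡⟨ cong₂ (λ u v → X + u + v) (sym a-term) (cong 𝟙 (sym Pb)) ⟩
        X + δ̸ b a * f a + f b     ≡⟨ cong (_+ f b) (∑-δ̸ (λ c → δ̸ b c * f c) a) ⟩
        ∑[ c < n ] (δ̸ b c * f c) + f b ≡⟨ ∑-δ̸ f b ⟩
        k                         ∎
    per-point : ∀ a → f a * ∑[ b < n ] ∑[ c < n ] (δ̸ a b * f b * (δ̸ a c * (δ̸ b c * f c))) ≡ f a * ((k ∸ 1) * (k ∸ 2))
    per-point a with P a in Pa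
    ... | false = refl
    ... | true  = cong (1 *_) (begin
      ∑[ b < n ] ∑[ c < n ] (δ̸ a b * f b * (δ̸ a c * (δ̸ b c * f c)))
        ≡⟨ sum-cong-≗ (λ b → sym (*-distribˡ-sum (δ̸ a b * f b) (λ c → δ̸ a c * (δ̸ b c * f c)))) ⟩
      ∑[ b < n ] (δ̸ a b * f b * ∑[ c < n ] (δ̸ a c * (δ̸ b c * f c)))
        ≡⟨ sum-cong-≗ inner ⟩
      ∑[ b < n ] (δ̸ a b * f b * (k ∸ 2))
        ≡⟨ sym (*-distribʳ-sum (k ∸ 2) (λ b → δ̸ a b * f b)) ⟩
      ∑[ b < n ] (δ̸ a b * f b) * (k ∸ 2)
        ≡⟨ cong (_* (k ∸ 2)) (others₁ a Pa) ⟩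
      (k ∸ 1) * (k ∸ 2) ∎)
      where
      inner : ∀ b → δ̸ a b * f b * ∑[ c < n ] (δ̸ a c * (δ̸ b c * f c)) ≡ δ̸ a b * f b * (k ∸ 2)
      inner b with a Fin.≟ b
      ... | yes _   = refl
      ... | no  a≢b with P b in Pb
      ...   | false = refl
      ...   | true  = cong (1 * 1 *_) (others₂ a b Pa Pb a≢b)

  count-distinct-triples : ∀ n → ∑≠ {n} (λ _ _ _ → 1) ≡ n * (n ∸ 1) * (n ∸ 2)
  count-distinct-triples n = trans (∑≠-subset {n} (λ _ → true))
    (cong (λ k → k * (k ∸ 1) * (k ∸ 2)) (trans (∑-const n 1) (ℕ.*-identityʳ n)))

  Equivariant : (Fin n → Fin n → Fin n → Perm n → ℕ) → Set
  Equivariant {n} S = ∀ (i j a b c : Fin n) π →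
    S a b c (conj i j π) ≡ S (transpose i j a) (transpose i j b) (transpose i j c) π

  module TripleSums {λp : List ℕ} {C : List (Perm n)} (C-unique : Unique C) (C-class : IsConjugacyClass λp C)
                    (S : Fin n → Fin n → Fin n → Perm n → ℕ) (S-equivariant : Equivariant S) where
    open ClassSums {λp = λp} C-unique C-class

    ΣS : Fin n → Fin n → Fin n → ℕ
    ΣS a b c = sum (map (S a b c) C)

    ΣS-transpose : ∀ (i j a b c : Fin n) → ΣS a b c ≡ ΣS (transpose i j a) (transpose i j b) (transpose i j c)
    ΣS-transpose i j a b c = trans (sym (sum-conj i j (S a b c))) (cong sum (List.map-cong (S-equivariant i j a b c) C))

    -- three transpositions carry (a, b, c) to (x, y, z) one coordinate at a time
    ΣS-distinct : ∀ {a b c x y z} → Distinct a b c → Distinct x y z → ΣS a b c ≡ ΣS x y z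
    ΣS-distinct {a} {b} {c} {x} {y} {z} (a≢b , a≢c , b≢c) (x≢y , x≢z , y≢z) = begin
      ΣS a b c
        ≡⟨ ΣS-transpose a x a b c ⟩
      ΣS (transpose a x a) b₁ c₁
        ≡⟨ cong (λ t → ΣS t b₁ c₁) (transpose-matchˡ a x) ⟩
      ΣS x b₁ c₁
        ≡⟨ ΣS-transpose b₁ y x b₁ c₁ ⟩
      ΣS (transpose b₁ y x) (transpose b₁ y b₁) c₂
        ≡⟨ cong₂ (λ s t → ΣS s t c₂) (transpose-fix x≢b₁ x≢y) (transpose-matchˡ b₁ y) ⟩
      ΣS x y c₂
        ≡⟨ ΣS-transpose c₂ z x y c₂ ⟩
      ΣS (transpose c₂ z x) (transpose c₂ z y) (transpose c₂ z c₂)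
        ≡⟨ cong₂ (λ s t → ΣS s t (transpose c₂ z c₂)) (transpose-fix x≢c₂ x≢z) (transpose-fix y≢c₂ y≢z) ⟩
      ΣS x y (transpose c₂ z c₂)
        ≡⟨ cong (ΣS x y) (transpose-matchˡ c₂ z) ⟩
      ΣS x y z ∎
      where
      open ≡-Reasoning
      b₁ = transpose a x b
      c₁ = transpose a x c
      c₂ = transpose b₁ y c₁
      x≢b₁ : x ≢ b₁
      x≢b₁ = subst (_≢ b₁) (transpose-matchˡ a x) (transpose-≢ a x a≢b)
      x≢c₁ : x ≢ c₁
      x≢c₁ = subst (_≢ c₁) (transpose-matchˡ a x) (transpose-≢ a x a≢c)
      x≢c₂ : x ≢ c₂
      x≢c₂ = subst (_≢ c₂) (transpose-fix x≢b₁ x≢y) (transpose-≢ b₁ y x≢c₁)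
      y≢c₂ : y ≢ c₂
      y≢c₂ = subst (_≢ c₂) (transpose-matchˡ b₁ y) (transpose-≢ b₁ y (transpose-≢ a x b≢c))

    ΣS-double-count : ∀ {x y z} → Distinct x y z →
                      n * (n ∸ 1) * (n ∸ 2) * ΣS x y z ≡ sum (map (λ π → ∑≠ (λ a b c → S a b c π)) C)
    ΣS-double-count {x} {y} {z} xyz = begin
      n * (n ∸ 1) * (n ∸ 2) * ΣS x y z           ≡⟨ cong (_* ΣS x y z) (count-distinct-triples n) ⟨
      ∑≠ {n} (λ _ _ _ → 1) * ΣS x y z             ≡⟨ ∑≠-*ʳ {n} (λ _ _ _ → 1) (ΣS x y z) ⟨
      ∑≠ {n} (λ _ _ _ → 1 * ΣS x y z)
        ≡⟨ ∑≠-cong (λ abc → trans (ΣS-distinct abc xyz) (sym (ℕ.*-identityˡ (ΣS x y z)))) ⟨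
      ∑≠ ΣS                                        ≡⟨ sum-map-∑≠ (λ π a b c → S a b c π) C ⟨
      sum (map (λ π → ∑≠ (λ a b c → S a b c π)) C) ∎
      where open ≡-Reasoning

  first-≥ : ∀ {k} (p : ℕ → Bool) {ts} → All.All (k ℕ.≤_) ts → first p ts ≡ 0 ⊎ k ℕ.≤ first p ts
  first-≥ p []                       = inj₁ refl
  first-≥ p {t ∷ ts} (k≤t ∷ k≤ts) with p t
  ... | true  = inj₂ k≤t
  ... | false = first-≥ p k≤ts

  module _ {m : ℕ} (π : Perm (3 + m)) (a : Fin (3 + m)) where

    π¹ π² π³ : Fin (3 + m)
    π¹ = lookup π a
    π² = lookup π π¹
    π³ = lookup π π²

    private
      -- the first return time of a to itself beyond 3, or 0 if there is none
      laterReturn : ℕ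
      laterReturn = first (λ k → does (iter π k a Fin.≟ a)) (map suc (List.applyUpTo (3 +_) m))

      laterReturn-≥4 : laterReturn ≡ 0 ⊎ 4 ℕ.≤ laterReturn
      laterReturn-≥4 = first-≥ _ (AllP.map⁺ (AllP.applyUpTo⁺₂ (3 +_) m (λ i → ℕ.s≤s (ℕ.s≤s (ℕ.s≤s (ℕ.s≤s ℕ.z≤n))))))

      laterReturn-≢ : ∀ {k} → 0 ℕ.< k → k ℕ.< 4 → laterReturn ≢ k
      laterReturn-≢ 0<k k<4 eq with laterReturn-≥4
      ... | inj₁ ≡0  = ℕ.<-irrefl (trans (sym ≡0) eq) 0<k
      ... | inj₂ 4≤ = ℕ.<-irrefl refl (ℕ.<-≤-trans k<4 (subst (4 ℕ.≤_) eq 4≤))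

      orbitLen-unfold : orbitLen π a ≡ (if does (π¹ Fin.≟ a) then 1 else if does (π² Fin.≟ a) then 2
                                        else if does (π³ Fin.≟ a) then 3 else laterReturn)
      orbitLen-unfold = refl

    orbitLen≡1 : does (orbitLen π a ℕ.≟ 1) ≡ does (π¹ Fin.≟ a)
    orbitLen≡1 rewrite orbitLen-unfold with does (π¹ Fin.≟ a)
    ... | true  = refl
    ... | false with does (π² Fin.≟ a)
    ...   | true  = refl
    ...   | false with does (π³ Fin.≟ a)
    ...     | true  = refl
    ...     | false = dec-false (laterReturn ℕ.≟ 1) (laterReturn-≢ (ℕ.s≤s ℕ.z≤n) (ℕ.s≤s (ℕ.s≤s ℕ.z≤n)))

    private
      orbitLen-fixed : π¹ ≡ a → orbitLen π a ≡ 1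
      orbitLen-fixed e rewrite orbitLen-unfold | dec-true (π¹ Fin.≟ a) e = refl

      orbitLen-period₂ : π¹ ≢ a → π² ≡ a → orbitLen π a ≡ 2
      orbitLen-period₂ π¹≢a e rewrite orbitLen-unfold | dec-false (π¹ Fin.≟ a) π¹≢a | dec-true (π² Fin.≟ a) e = refl

      orbitLen≡3⇒distinct : IsPerm π → orbitLen π a ≡ 3 → Distinct a π¹ π²
      orbitLen≡3⇒distinct π-inj len≡3 = a≢π¹ , a≢π² , λ e → a≢π¹ (π-inj a π¹ e)
        where
        1≢3 : 1 ≢ 3
        1≢3 ()
        2≢3 : 2 ≢ 3
        2≢3 ()
        a≢π¹ : a ≢ π¹
        a≢π¹ e = 1≢3 (trans (sym (orbitLen-fixed (sym e))) len≡3)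
        a≢π² : a ≢ π²
        a≢π² e = by-cases (π¹ Fin.≟ a)
          where
          by-cases : Dec (π¹ ≡ a) → ⊥
          by-cases (yes π¹≡a) = a≢π¹ (sym π¹≡a)
          by-cases (no  π¹≢a) = 2≢3 (trans (sym (orbitLen-period₂ π¹≢a (sym e))) len≡3)

    orbitLen≡3 : IsPerm π → 𝟙 (does (orbitLen π a ℕ.≟ 3)) ≡ 𝟙 (distinct? a π¹ π²) * δ π³ a
    orbitLen≡3 π-inj with distinct? a π¹ π² | distinctView a π¹ π²
    ... | false | repeated ¬distinct = cong 𝟙 (dec-false (orbitLen π a ℕ.≟ 3) (¬distinct ∘ orbitLen≡3⇒distinct π-inj))
    ... | true  | all-distinct (a≢π¹ , a≢π² , _)
      rewrite orbitLen-unfold | dec-false (π¹ Fin.≟ a) (a≢π¹ ∘ sym) | dec-false (π² Fin.≟ a) (a≢π² ∘ sym)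
      with does (π³ Fin.≟ a)
    ... | true  = refl
    ... | false = cong 𝟙 (dec-false (laterReturn ℕ.≟ 3) (laterReturn-≢ (ℕ.s≤s ℕ.z≤n) ℕ.≤-refl))

  maps : Fin n → Fin n → Fin n → Fin n → Fin n → Fin n → Perm n → ℕ
  maps a b c a′ b′ c′ π = δ (lookup π a) a′ * δ (lookup π b) b′ * δ (lookup π c) c′

  fixes cycles : Fin n → Fin n → Fin n → Perm n → ℕ
  fixes  a b c = maps a b c a b c
  cycles a b c = maps a b c b c a

  δ-conj : ∀ (i j : Fin n) π a b → δ (lookup (conj i j π) a) b ≡ δ (lookup π (transpose i j a)) (transpose i j b)
  δ-conj i j π a b rewrite lookup-conj i j π a = cong 𝟙 (does-transpose i j (lookup π (transpose i j a)) b)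

  maps-conj : ∀ (i j : Fin n) a b c a′ b′ c′ π → maps a b c a′ b′ c′ (conj i j π) ≡
              maps (transpose i j a) (transpose i j b) (transpose i j c) (transpose i j a′) (transpose i j b′) (transpose i j c′) π
  maps-conj i j a b c a′ b′ c′ π = cong₂ _*_ (cong₂ _*_ (δ-conj i j π a a′) (δ-conj i j π b b′)) (δ-conj i j π c c′)

  fixes-equivariant : Equivariant {n} fixes
  fixes-equivariant i j a b c = maps-conj i j a b c a b c

  cycles-equivariant : Equivariant {n} cycles
  cycles-equivariant i j a b c = maps-conj i j a b c b c a

  module _ {m : ℕ} {π : Perm (3 + m)} {λp : List ℕ} where

    fixedPoints : HasCycleType π λp → ∑[ a < 3 + m ] δ (lookup π a) a ≡ mult 1 λp
    fixedPoints type = begin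
      ∑[ a < 3 + m ] δ (lookup π a) a
        ≡⟨ sum-cong-≗ (λ a → cong 𝟙 (orbitLen≡1 π a)) ⟨
      ∑[ a < 3 + m ] 𝟙 (does (orbitLen π a ℕ.≟ 1))
        ≡⟨ count-allFin (λ a → orbitLen π a ℕ.≟ 1) ⟨
      length (filter (λ a → orbitLen π a ℕ.≟ 1) (allFin (3 + m)))
        ≡⟨ type 1 ⟨
      1 * mult 1 λp
        ≡⟨ ℕ.*-identityˡ (mult 1 λp) ⟩
      mult 1 λp ∎
      where open ≡-Reasoning

    threeCyclePoints : HasCycleType π λp → ∑[ a < 3 + m ] 𝟙 (does (orbitLen π a ℕ.≟ 3)) ≡ 3 * mult 3 λp
    threeCyclePoints type = trans (sym (count-allFin (λ a → orbitLen π a ℕ.≟ 3))) (sym (type 3))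

    ∑≠-fixes : HasCycleType π λp → let p = mult 1 λp in ∑≠ (λ a b c → fixes a b c π) ≡ p * (p ∸ 1) * (p ∸ 2)
    ∑≠-fixes type = trans (∑≠-subset (λ a → does (lookup π a Fin.≟ a)))
                          (cong (λ k → k * (k ∸ 1) * (k ∸ 2)) (fixedPoints type))

    ∑≠-cycles : IsPerm π → HasCycleType π λp → ∑≠ (λ a b c → cycles a b c π) ≡ 3 * mult 3 λp
    ∑≠-cycles π-inj type = begin
      ∑[ a < N ] ∑[ b < N ] ∑[ c < N ] (𝟙 (distinct? a b c) * (δ (π′ a) b * δ (π′ b) c * δ (π′ c) a))
        ≡⟨ sum-cong-≗ (λ a → sum-cong-≗ (λ b → trans (sum-cong-≗ (λ c → regroup a b c))
                                                      (sym (*-distribˡ-sum (δ (π′ a) b) (λ c → δ (π′ b) c * (𝟙 (distinct? a b c) * δ (π′ c) a)))))) ⟩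
      ∑[ a < N ] ∑[ b < N ] (δ (π′ a) b * ∑[ c < N ] (δ (π′ b) c * (𝟙 (distinct? a b c) * δ (π′ c) a)))
        ≡⟨ sum-cong-≗ (λ a → sum-cong-≗ (λ b → cong (δ (π′ a) b *_) (∑-δ (λ c → 𝟙 (distinct? a b c) * δ (π′ c) a) (π′ b)))) ⟩
      ∑[ a < N ] ∑[ b < N ] (δ (π′ a) b * (𝟙 (distinct? a b (π′ b)) * δ (π′ (π′ b)) a))
        ≡⟨ sum-cong-≗ (λ a → ∑-δ (λ b → 𝟙 (distinct? a b (π′ b)) * δ (π′ (π′ b)) a) (π′ a)) ⟩
      ∑[ a < N ] (𝟙 (distinct? a (π′ a) (π′ (π′ a))) * δ (π′ (π′ (π′ a))) a)
        ≡⟨ sum-cong-≗ (λ a → orbitLen≡3 π a π-inj) ⟨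
      ∑[ a < N ] 𝟙 (does (orbitLen π a ℕ.≟ 3))
        ≡⟨ threeCyclePoints type ⟩
      3 * mult 3 λp ∎
      where
      open ≡-Reasoning
      N = 3 + m
      π′ = lookup π
      regroup : ∀ a b c → 𝟙 (distinct? a b c) * (δ (π′ a) b * δ (π′ b) c * δ (π′ c) a)
                          ≡ δ (π′ a) b * (δ (π′ b) c * (𝟙 (distinct? a b c) * δ (π′ c) a))
      regroup a b c = shuffle (𝟙 (distinct? a b c)) (δ (π′ a) b) (δ (π′ b) c) (δ (π′ c) a)
        where shuffle : ∀ w x y z → w * (x * y * z) ≡ x * (y * (w * z))
              shuffle = ℕ-solve-∀

  peakAt : Perm n → Fin n → Fin n → Fin n → ℕ
  peakAt π x y z = peakℕ (toℕ (lookup π x)) (toℕ (lookup π y)) (toℕ (lookup π z))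

  δ-toℕ : ∀ (a b : Fin n) → δ a b ≡ 𝟙 (toℕ a ℕ.≡ᵇ toℕ b)
  δ-toℕ a b with a Fin.≟ b
  ... | yes refl = cong 𝟙 (sym (≡ᵇ-true {toℕ a} refl))
  ... | no  a≢b  = cong 𝟙 (sym (≡ᵇ-false (a≢b ∘ Fin.toℕ-injective)))

  toℕ-transpose : ∀ (i j k : Fin n) → toℕ (transpose i j k) ≡ swapℕ (toℕ i) (toℕ j) (toℕ k)
  toℕ-transpose i j k with k Fin.≟ i
  ... | yes refl rewrite ≡ᵇ-true {toℕ k} refl = refl
  ... | no  k≢i rewrite ≡ᵇ-false (k≢i ∘ Fin.toℕ-injective) with k Fin.≟ j
  ...   | yes refl rewrite ≡ᵇ-true {toℕ k} refl = refl
  ...   | no  k≢j rewrite ≡ᵇ-false (k≢j ∘ Fin.toℕ-injective) = refl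

  module ConsecutiveWindow {x y z : Fin n} (y≡ : toℕ y ≡ 1 + toℕ x) (z≡ : toℕ z ≡ 2 + toℕ x) where

    X : ℕ
    X = toℕ x

    y≢x : y ≢ x
    y≢x y≡x = ℕ.1+n≢n (trans (sym y≡) (cong toℕ y≡x))
    z≢x : z ≢ x
    z≢x z≡x = ℕ.<⇒≢ (ℕ.m<n+m X {2} (ℕ.s≤s ℕ.z≤n)) (trans (sym (cong toℕ z≡x)) z≡)
    z≢y : z ≢ y
    z≢y z≡y = ℕ.1+n≢n (trans (sym z≡) (trans (cong toℕ z≡y) y≡))
    x≢y : x ≢ y
    x≢y = y≢x ∘ sym
    x≢z : x ≢ z
    x≢z = z≢x ∘ sym
    y≢z : y ≢ z
    y≢z = z≢y ∘ sym

    toℕ-τxy : ∀ v → toℕ (transpose x y v) ≡ τ₀₁ X (toℕ v)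
    toℕ-τxy v = trans (toℕ-transpose x y v) (cong (λ t → swapℕ X t (toℕ v)) y≡)
    toℕ-τyz : ∀ v → toℕ (transpose y z v) ≡ τ₁₂ X (toℕ v)
    toℕ-τyz v = trans (toℕ-transpose y z v) (cong₂ (λ s t → swapℕ s t (toℕ v)) y≡ z≡)
    toℕ-τxz : ∀ v → toℕ (transpose x z v) ≡ τ₀₂ X (toℕ v)
    toℕ-τxz v = trans (toℕ-transpose x z v) (cong (λ t → swapℕ X t (toℕ v)) z≡)

    module _ (π : Perm n) where

      U V W : ℕ
      U = toℕ (lookup π x)
      V = toℕ (lookup π y)
      W = toℕ (lookup π z)

      conjugatePeaksAt : ℕ
      conjugatePeaksAt = peakAt π x y z + peakAt (conj x y π) x y z + peakAt (conj y z π) x y z + peakAt (conj x z π) x y z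
                       + peakAt (conj x y (conj y z π)) x y z + peakAt (conj y z (conj x y π)) x y z

      private
        value₁ : ∀ {i j} (σ : ℕ → ℕ) → (∀ v → toℕ (transpose i j v) ≡ σ (toℕ v)) →
                 ∀ {k k′} → transpose i j k ≡ k′ → toℕ (lookup (conj i j π) k) ≡ σ (toℕ (lookup π k′))
        value₁ {i} {j} σ toℕ-τ {k} refl = trans (cong toℕ (lookup-conj i j π k)) (toℕ-τ _)

        value₂ : ∀ {i j i′ j′} (σ σ′ : ℕ → ℕ) →
                 (∀ v → toℕ (transpose i j v) ≡ σ (toℕ v)) → (∀ v → toℕ (transpose i′ j′ v) ≡ σ′ (toℕ v)) →
                 ∀ {k k′ k″} → transpose i j k ≡ k′ → transpose i′ j′ k′ ≡ k″ →
                 toℕ (lookup (conj i j (conj i′ j′ π)) k) ≡ σ (σ′ (toℕ (lookup π k″)))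
        value₂ {i} {j} {i′} {j′} σ σ′ toℕ-τ toℕ-τ′ {k} refl refl =
          trans (cong toℕ (lookup-conj i j (conj i′ j′ π) k)) (trans (toℕ-τ _)
                (cong σ (trans (cong toℕ (lookup-conj i′ j′ π (transpose i j k))) (toℕ-τ′ _))))

      conjugatePeaksAt≡ : conjugatePeaksAt ≡ conjugatePeaks X U V W
      conjugatePeaksAt≡ = cong₂ _+_ (cong₂ _+_ (cong₂ _+_ (cong₂ _+_ (cong₂ _+_ refl
        (peakℕ-cong (value₁ (τ₀₁ X) toℕ-τxy (transpose-matchˡ x y))
                   (value₁ (τ₀₁ X) toℕ-τxy (transpose-matchʳ x y))
                   (value₁ (τ₀₁ X) toℕ-τxy (transpose-fix z≢x z≢y))))
        (peakℕ-cong (value₁ (τ₁₂ X) toℕ-τyz (transpose-fix x≢y x≢z))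
                   (value₁ (τ₁₂ X) toℕ-τyz (transpose-matchˡ y z))
                   (value₁ (τ₁₂ X) toℕ-τyz (transpose-matchʳ y z))))
        (peakℕ-cong (value₁ (τ₀₂ X) toℕ-τxz (transpose-matchˡ x z))
                   (value₁ (τ₀₂ X) toℕ-τxz (transpose-fix y≢x y≢z))
                   (value₁ (τ₀₂ X) toℕ-τxz (transpose-matchʳ x z))))
        (peakℕ-cong (value₂ (τ₀₁ X) (τ₁₂ X) toℕ-τxy toℕ-τyz (transpose-matchˡ x y) (transpose-matchˡ y z))
                   (value₂ (τ₀₁ X) (τ₁₂ X) toℕ-τxy toℕ-τyz (transpose-matchʳ x y) (transpose-fix x≢y x≢z))
                   (value₂ (τ₀₁ X) (τ₁₂ X) toℕ-τxy toℕ-τyz (transpose-fix z≢x z≢y) (transpose-matchʳ y z))))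
        (peakℕ-cong (value₂ (τ₁₂ X) (τ₀₁ X) toℕ-τyz toℕ-τxy (transpose-fix x≢y x≢z) (transpose-matchˡ x y))
                   (value₂ (τ₁₂ X) (τ₀₁ X) toℕ-τyz toℕ-τxy (transpose-matchˡ y z) (transpose-fix z≢x z≢y))
                   (value₂ (τ₁₂ X) (τ₀₁ X) toℕ-τyz toℕ-τxy (transpose-matchʳ y z) (transpose-matchʳ x y)))

      private
        δ-at : ∀ (a b : Fin n) {t} → toℕ b ≡ t → δ a b ≡ 𝟙 (toℕ a ℕ.≡ᵇ t)
        δ-at a b refl = δ-toℕ a b

        product-cong : ∀ {a b c a′ b′ c′} → a ≡ a′ → b ≡ b′ → c ≡ c′ → a * b * c ≡ a′ * b′ * c′
        product-cong refl refl refl = refl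

      fixes≡ : fixes x y z π ≡ 𝟙 (U ℕ.≡ᵇ X) * 𝟙 (V ℕ.≡ᵇ 1 + X) * 𝟙 (W ℕ.≡ᵇ 2 + X)
      fixes≡ = product-cong (δ-at (lookup π x) x refl) (δ-at (lookup π y) y y≡) (δ-at (lookup π z) z z≡)

      cycles≡ : cycles x y z π ≡ 𝟙 (U ℕ.≡ᵇ 1 + X) * 𝟙 (V ℕ.≡ᵇ 2 + X) * 𝟙 (W ℕ.≡ᵇ X)
      cycles≡ = product-cong (δ-at (lookup π x) y y≡) (δ-at (lookup π y) z z≡) (δ-at (lookup π z) x refl)

      cycles′≡ : cycles x z y π ≡ 𝟙 (U ℕ.≡ᵇ 2 + X) * 𝟙 (W ℕ.≡ᵇ 1 + X) * 𝟙 (V ℕ.≡ᵇ X)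
      cycles′≡ = product-cong (δ-at (lookup π x) z z≡) (δ-at (lookup π z) y y≡) (δ-at (lookup π y) x refl)

      window-pointwise : IsPerm π → conjugatePeaksAt + 2 * fixes x y z π ≡ 2 + cycles x y z π + cycles x z y π
      window-pointwise π-inj = begin
        conjugatePeaksAt + 2 * fixes x y z π
          ≡⟨ cong₂ (λ s f → s + 2 * f) conjugatePeaksAt≡ fixes≡ ⟩
        window-lhs X U V W
          ≡⟨ window-identity X (values-differ x≢y , values-differ x≢z , values-differ y≢z) ⟩
        window-rhs X U V W
          ≡⟨ cong₂ (λ c c′ → 2 + c + c′) cycles≡ cycles′≡ ⟨
        2 + cycles x y z π + cycles x z y π ∎
        where
        open ≡-Reasoning
        values-differ : ∀ {a b} → a ≢ b → toℕ (lookup π a) ≢ toℕ (lookup π b)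
        values-differ a≢b eq = a≢b (π-inj _ _ (Fin.toℕ-injective eq))

  peaksList-∑ : ∀ {k} (v : Vec ℕ (2 + k)) →
    peaksList (Vec.toList v) ≡
    ∑[ i < k ] peakℕ (lookup v (Fin.inject₁ (Fin.inject₁ i))) (lookup v (suc (Fin.inject₁ i))) (lookup v (suc (suc i)))
  peaksList-∑ {zero}  (a Vec.∷ b Vec.∷ Vec.[])         = refl
  peaksList-∑ {suc k} (a Vec.∷ b Vec.∷ c Vec.∷ w) = cong (peakℕ a b c +_) (peaksList-∑ (b Vec.∷ c Vec.∷ w))

  module _ {m : ℕ} where

    window₀ window₁ window₂ : Fin (suc m) → Fin (3 + m)
    window₀  i = Fin.inject₁ (Fin.inject₁ i)
    window₁ i = suc (Fin.inject₁ i)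
    window₂  i = suc (suc i)

    peak≡∑peakAt : ∀ (π : Perm (3 + m)) → peak π ≡ ∑[ i < suc m ] peakAt π (window₀ i) (window₁ i) (window₂ i)
    peak≡∑peakAt π = begin
      peaksList (map toℕ (Vec.toList π))    ≡⟨ cong peaksList (Vec.toList-map toℕ π) ⟨
      peaksList (Vec.toList (Vec.map toℕ π)) ≡⟨ peaksList-∑ (Vec.map toℕ π) ⟩
      ∑[ i < suc m ] peakℕ (lookup (Vec.map toℕ π) (window₀ i)) (lookup (Vec.map toℕ π) (window₁ i)) (lookup (Vec.map toℕ π) (window₂ i))
        ≡⟨ sum-cong-≗ (λ i → peakℕ-cong (Vec.lookup-map (window₀ i) toℕ π) (Vec.lookup-map (window₁ i) toℕ π)
                                         (Vec.lookup-map (window₂ i) toℕ π)) ⟩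
      ∑[ i < suc m ] peakAt π (window₀ i) (window₁ i) (window₂ i) ∎
      where open ≡-Reasoning

    window₁≡ : ∀ i → toℕ (window₁ i) ≡ 1 + toℕ (window₀ i)
    window₁≡ i = cong suc (trans (Fin.toℕ-inject₁ i) (sym (trans (Fin.toℕ-inject₁ (Fin.inject₁ i)) (Fin.toℕ-inject₁ i))))

    window₂≡ : ∀ i → toℕ (window₂ i) ≡ 2 + toℕ (window₀ i)
    window₂≡ i = cong (2 +_) (sym (trans (Fin.toℕ-inject₁ (Fin.inject₁ i)) (Fin.toℕ-inject₁ i)))

  module WindowClassSums {m : ℕ} {λp : List ℕ} {C : List (Perm (3 + m))}
                         (C-unique : Unique C) (C-class : IsConjugacyClass λp C) where
    open ClassSums {λp = λp} C-unique C-class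

    N = 3 + m
    c = length C
    p = mult 1 λp
    r = mult 3 λp

    ΣC : (Perm N → ℕ) → ℕ
    ΣC h = sum (map h C)

    ΣC-const : ∀ {h : Perm N → ℕ} {k} → (∀ {π} → IsPerm π → HasCycleType π λp → h π ≡ k) → ΣC h ≡ c * k
    ΣC-const {h} {k} h≡k = trans (sum-map-cong (λ π∈C → let (π-perm , π-type) = members π∈C in h≡k π-perm π-type))
                                 (sum-map-const k C)

    module _ {x y z : Fin N} (y≡ : toℕ y ≡ 1 + toℕ x) (z≡ : toℕ z ≡ 2 + toℕ x) where
      open ConsecutiveWindow y≡ z≡

      peakAtWindow : Perm N → ℕ
      peakAtWindow π = peakAt π x y z

      peaks-by-symmetry : ΣC conjugatePeaksAt ≡ 6 * ΣC peakAtWindow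
      peaks-by-symmetry = begin
        ΣC conjugatePeaksAt
          ≡⟨ sum-map-+ s₄ h₅ C ⟩
        ΣC s₄ + ΣC h₅
          ≡⟨ cong (_+ ΣC h₅) (trans (sum-map-+ s₃ h₄ C) (cong (_+ ΣC h₄) (trans (sum-map-+ s₂ h₃ C)
               (cong (_+ ΣC h₃) (trans (sum-map-+ s₁ h₂ C) (cong (_+ ΣC h₂) (sum-map-+ h h₁ C))))))) ⟩
        ΣC h + ΣC h₁ + ΣC h₂ + ΣC h₃ + ΣC h₄ + ΣC h₅
          ≡⟨ cong₂ _+_ (cong₂ _+_ (cong₂ _+_ (cong₂ _+_ (cong (ΣC h +_) (sum-conj x y h))
                        (sum-conj y z h)) (sum-conj x z h))
                        (trans (sum-conj y z (h ∘ conj x y)) (sum-conj x y h)))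
                        (trans (sum-conj x y (h ∘ conj y z)) (sum-conj y z h)) ⟩
        ΣC h + ΣC h + ΣC h + ΣC h + ΣC h + ΣC h
          ≡⟨ six (ΣC h) ⟩
        6 * ΣC h ∎
        where
        open ≡-Reasoning
        h h₁ h₂ h₃ h₄ h₅ s₁ s₂ s₃ s₄ : Perm N → ℕ
        h = peakAtWindow
        h₁ π = h (conj x y π)
        h₂ π = h (conj y z π)
        h₃ π = h (conj x z π)
        h₄ π = h (conj x y (conj y z π))
        h₅ π = h (conj y z (conj x y π))
        s₁ π = h π + h₁ π
        s₂ π = s₁ π + h₂ π
        s₃ π = s₂ π + h₃ π
        s₄ π = s₃ π + h₄ π
        six : ∀ a → a + a + a + a + a + a ≡ 6 * a
        six = ℕ-solve-∀

      window-class : 6 * ΣC peakAtWindow + 2 * ΣC (fixes x y z) ≡ 2 * c + ΣC (cycles x y z) + ΣC (cycles x z y)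
      window-class = begin
        6 * ΣC peakAtWindow + 2 * ΣC (fixes x y z)
          ≡⟨ cong₂ _+_ peaks-by-symmetry (sum-map-* 2 (fixes x y z) C) ⟨
        ΣC conjugatePeaksAt + ΣC (λ π → 2 * fixes x y z π)
          ≡⟨ sum-map-+ conjugatePeaksAt (λ π → 2 * fixes x y z π) C ⟨
        ΣC (λ π → conjugatePeaksAt π + 2 * fixes x y z π)
          ≡⟨ sum-map-cong (λ {π} π∈C → window-pointwise π (proj₁ (members π∈C))) ⟩
        ΣC (λ π → 2 + cycles x y z π + cycles x z y π)
          ≡⟨ sum-map-+ (λ π → 2 + cycles x y z π) (cycles x z y) C ⟩
        ΣC (λ π → 2 + cycles x y z π) + ΣC (cycles x z y)
          ≡⟨ cong (_+ ΣC (cycles x z y)) (trans (sum-map-+ (λ _ → 2) (cycles x y z) C)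
                                                (cong (_+ ΣC (cycles x y z)) (trans (sum-map-const 2 C) (ℕ.*-comm c 2)))) ⟩
        2 * c + ΣC (cycles x y z) + ΣC (cycles x z y) ∎
        where open ≡-Reasoning

    D₃ : ℕ
    D₃ = N * (N ∸ 1) * (N ∸ 2)

    fixes-count : ∀ {a b c′} → Distinct a b c′ → D₃ * ΣC (fixes a b c′) ≡ c * (p * (p ∸ 1) * (p ∸ 2))
    fixes-count abc = trans (ΣS-double-count abc) (ΣC-const (λ {π} _ → ∑≠-fixes {π = π} {λp = λp}))
      where open TripleSums {λp = λp} C-unique C-class fixes fixes-equivariant

    cycles-count : ∀ {a b c′} → Distinct a b c′ → D₃ * ΣC (cycles a b c′) ≡ c * (3 * r)
    cycles-count abc = trans (ΣS-double-count abc) (ΣC-const (λ {π} → ∑≠-cycles {π = π} {λp = λp}))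
      where open TripleSums {λp = λp} C-unique C-class cycles cycles-equivariant

    window-peaks : ∀ {x y z : Fin N} → toℕ y ≡ 1 + toℕ x → toℕ z ≡ 2 + toℕ x →
                   6 * D₃ * ΣC (λ π → peakAt π x y z) + 2 * c * (p * (p ∸ 1) * (p ∸ 2)) ≡ 2 * c * D₃ + 6 * c * r
    window-peaks {x} {y} {z} y≡ z≡ = begin
      6 * D₃ * M + 2 * c * P₃           ≡⟨ cong (6 * D₃ * M +_) (ℕ.*-assoc 2 c P₃) ⟩
      6 * D₃ * M + 2 * (c * P₃)         ≡⟨ cong (λ t → 6 * D₃ * M + 2 * t) (fixes-count (x≢y , x≢z , y≢z)) ⟨
      6 * D₃ * M + 2 * (D₃ * F)         ≡⟨ factor D₃ M F ⟩
      D₃ * (6 * M + 2 * F)              ≡⟨ cong (D₃ *_) (window-class y≡ z≡) ⟩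
      D₃ * (2 * c + Y + Y′)             ≡⟨ expand D₃ c Y Y′ ⟩
      2 * c * D₃ + D₃ * Y + D₃ * Y′     ≡⟨ cong₂ (λ u v → 2 * c * D₃ + u + v) (cycles-count (x≢y , x≢z , y≢z))
                                                                            (cycles-count (x≢z , x≢y , z≢y)) ⟩
      2 * c * D₃ + c * (3 * r) + c * (3 * r) ≡⟨ collect c D₃ r ⟩
      2 * c * D₃ + 6 * c * r            ∎
      where
      open ≡-Reasoning
      open ConsecutiveWindow y≡ z≡ using (x≢y; x≢z; y≢z; z≢y)
      M = ΣC (λ π → peakAt π x y z)
      F = ΣC (fixes x y z)
      Y = ΣC (cycles x y z)
      Y′ = ΣC (cycles x z y)
      P₃ = p * (p ∸ 1) * (p ∸ 2)
      factor : ∀ d a b → 6 * d * a + 2 * (d * b) ≡ d * (6 * a + 2 * b)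
      factor = ℕ-solve-∀
      expand : ∀ d a b b′ → d * (2 * a + b + b′) ≡ 2 * a * d + d * b + d * b′
      expand = ℕ-solve-∀
      collect : ∀ a d r → 2 * a * d + a * (3 * r) + a * (3 * r) ≡ 2 * a * d + 6 * a * r
      collect = ℕ-solve-∀

    -- the window identity holds at each of the m + 1 windows; summing, the factor m + 1 of D₃ cancels
    peak-sum : 6 * (N * (N ∸ 1)) * ΣC peak + 2 * c * (p * (p ∸ 1) * (p ∸ 2)) ≡ 2 * c * D₃ + 6 * c * r
    peak-sum = ℕ.*-cancelˡ-≡ _ _ (suc m) (begin
      suc m * (6 * K * ΣC peak + 2 * c * P₃)
        ≡⟨ distribute (suc m) K (ΣC peak) (2 * c * P₃) ⟩
      6 * D₃ * ΣC peak + suc m * (2 * c * P₃)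
        ≡⟨ cong₂ (λ s t → 6 * D₃ * s + t) peaks-by-window (sym (∑-const (suc m) (2 * c * P₃))) ⟩
      6 * D₃ * ∑[ i < suc m ] M i + ∑[ i < suc m ] (2 * c * P₃)
        ≡⟨ cong (_+ ∑[ i < suc m ] (2 * c * P₃)) (*-distribˡ-sum (6 * D₃) M) ⟩
      ∑[ i < suc m ] (6 * D₃ * M i) + ∑[ i < suc m ] (2 * c * P₃)
        ≡⟨ ∑-distrib-+ (λ i → 6 * D₃ * M i) (λ _ → 2 * c * P₃) ⟨
      ∑[ i < suc m ] (6 * D₃ * M i + 2 * c * P₃)
        ≡⟨ sum-cong-≗ (λ i → window-peaks (window₁≡ i) (window₂≡ i)) ⟩
      ∑[ i < suc m ] (2 * c * D₃ + 6 * c * r)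
        ≡⟨ ∑-const (suc m) (2 * c * D₃ + 6 * c * r) ⟩
      suc m * (2 * c * D₃ + 6 * c * r) ∎)
      where
      open ≡-Reasoning
      K = N * (N ∸ 1)
      P₃ = p * (p ∸ 1) * (p ∸ 2)
      M : Fin (suc m) → ℕ
      M i = ΣC (λ π → peakAt π (window₀ i) (window₁ i) (window₂ i))
      peaks-by-window : ΣC peak ≡ ∑[ i < suc m ] M i
      peaks-by-window = trans (cong sum (List.map-cong peak≡∑peakAt C))
                              (sum-map-∑ (λ π i → peakAt π (window₀ i) (window₁ i) (window₂ i)) C)
      distribute : ∀ s k S q → s * (6 * k * S + q) ≡ 6 * (k * s) * S + s * q
      distribute = ℕ-solve-∀

module Rationals where

  open import Data.Integer as ℤ using (ℤ; +_; 1ℤ)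
  import Data.Integer.Properties as ℤ
  open import Data.Integer.Tactic.RingSolver using (solve-∀)
  open import Data.Nat as ℕ using (ℕ; suc; _∸_)
  open import Data.Rational as ℚ using (ℚ; _/_; 1ℚ; toℚᵘ)
  import Data.Rational.Properties as ℚ
  open import Data.Rational.Solver using (module +-*-Solver)
  open import Data.Rational.Unnormalised as ℚᵘ using (mkℚᵘ; *≡*) renaming (_≃_ to _≃ᵘ_)
  import Data.Rational.Unnormalised.Properties as ℚᵘ
  open import Relation.Binary.PropositionalEquality

  ι : ℤ → ℚ
  ι z = z / 1

  private
    toℚᵘ-/ : ∀ i k → toℚᵘ (i / suc k) ≃ᵘ mkℚᵘ i k
    toℚᵘ-/ i k = ℚ.toℚᵘ-fromℚᵘ (mkℚᵘ i k)

  ι-+ : ∀ a b → ι (a ℤ.+ b) ≡ ι a ℚ.+ ι b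
  ι-+ a b = ℚ.toℚᵘ-injective (begin
    toℚᵘ (ι (a ℤ.+ b))          ≈⟨ toℚᵘ-/ (a ℤ.+ b) 0 ⟩
    mkℚᵘ (a ℤ.+ b) 0            ≈⟨ *≡* (cross a b) ⟩
    mkℚᵘ a 0 ℚᵘ.+ mkℚᵘ b 0      ≈⟨ ℚᵘ.+-cong (toℚᵘ-/ a 0) (toℚᵘ-/ b 0) ⟨
    toℚᵘ (ι a) ℚᵘ.+ toℚᵘ (ι b)  ≈⟨ ℚ.toℚᵘ-homo-+ (ι a) (ι b) ⟨
    toℚᵘ (ι a ℚ.+ ι b)          ∎)
    where
    open ℚᵘ.≃-Reasoning
    cross : ∀ a b → (a ℤ.+ b) ℤ.* 1ℤ ≡ (a ℤ.* 1ℤ ℤ.+ b ℤ.* 1ℤ) ℤ.* 1ℤ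
    cross = solve-∀

  ι-* : ∀ a b → ι (a ℤ.* b) ≡ ι a ℚ.* ι b
  ι-* a b = ℚ.toℚᵘ-injective (begin
    toℚᵘ (ι (a ℤ.* b))          ≈⟨ toℚᵘ-/ (a ℤ.* b) 0 ⟩
    mkℚᵘ (a ℤ.* b) 0            ≈⟨ ℚᵘ.*-cong (toℚᵘ-/ a 0) (toℚᵘ-/ b 0) ⟨
    toℚᵘ (ι a) ℚᵘ.* toℚᵘ (ι b)  ≈⟨ ℚ.toℚᵘ-homo-* (ι a) (ι b) ⟨
    toℚᵘ (ι a ℚ.* ι b)          ∎)
    where open ℚᵘ.≃-Reasoning

  ι-neg : ∀ a → ι (ℤ.- a) ≡ ℚ.- ι a
  ι-neg a = ℚ.toℚᵘ-injective (begin
    toℚᵘ (ι (ℤ.- a))            ≈⟨ toℚᵘ-/ (ℤ.- a) 0 ⟩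
    mkℚᵘ (ℤ.- a) 0              ≈⟨ ℚᵘ.-‿cong (toℚᵘ-/ a 0) ⟨
    ℚᵘ.- toℚᵘ (ι a)             ≈⟨ ℚ.toℚᵘ-homo‿- (ι a) ⟨
    toℚᵘ (ℚ.- ι a)              ∎)
    where open ℚᵘ.≃-Reasoning

  ι-- : ∀ a b → ι (a ℤ.- b) ≡ ι a ℚ.- ι b
  ι-- a b = trans (ι-+ a (ℤ.- b)) (cong (ι a ℚ.+_) (ι-neg b))

  /3-as-* : ∀ a → + a / 3 ≡ ι (+ a) ℚ.* (+ 1 / 3)
  /3-as-* a = ℚ.toℚᵘ-injective (begin
    toℚᵘ (+ a / 3)                     ≈⟨ toℚᵘ-/ (+ a) 2 ⟩
    mkℚᵘ (+ a) 2                       ≈⟨ *≡* (cross (+ a)) ⟩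
    mkℚᵘ (+ a) 0 ℚᵘ.* mkℚᵘ 1ℤ 2        ≈⟨ ℚᵘ.*-cong (toℚᵘ-/ (+ a) 0) (toℚᵘ-/ 1ℤ 2) ⟨
    toℚᵘ (ι (+ a)) ℚᵘ.* toℚᵘ (+ 1 / 3) ≈⟨ ℚ.toℚᵘ-homo-* (ι (+ a)) (+ 1 / 3) ⟨
    toℚᵘ (ι (+ a) ℚ.* (+ 1 / 3))       ∎)
    where
    open ℚᵘ.≃-Reasoning
    cross : ∀ x → x ℤ.* + 3 ≡ (x ℤ.* 1ℤ) ℤ.* + 3
    cross x = cong (ℤ._* + 3) (sym (ℤ.*-identityʳ x))

  /-inverse : ∀ k → ι (+ suc k) ℚ.* (+ 1 / suc k) ≡ 1ℚ
  /-inverse k = ℚ.toℚᵘ-injective (begin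
    toℚᵘ (ι (+ suc k) ℚ.* (+ 1 / suc k))       ≈⟨ ℚ.toℚᵘ-homo-* (ι (+ suc k)) (+ 1 / suc k) ⟩
    toℚᵘ (ι (+ suc k)) ℚᵘ.* toℚᵘ (+ 1 / suc k) ≈⟨ ℚᵘ.*-cong (toℚᵘ-/ (+ suc k) 0) (toℚᵘ-/ 1ℤ k) ⟩
    mkℚᵘ (+ suc k) 0 ℚᵘ.* mkℚᵘ 1ℤ k            ≈⟨ ℚᵘ.*-inverseʳ (mkℚᵘ (+ suc k) 0) ⟩
    ℚᵘ.1ℚᵘ                                     ∎)
    where open ℚᵘ.≃-Reasoning

  solve-for-s : ∀ s c t X T K i₃ iK → T ℚ.* i₃ ≡ 1ℚ → K ℚ.* iK ≡ 1ℚ →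
                T ℚ.* K ℚ.* s ≡ c ℚ.* K ℚ.* t ℚ.- T ℚ.* c ℚ.* X →
                s ≡ c ℚ.* ((t ℚ.* i₃) ℚ.* 1ℚ ℚ.- iK ℚ.* X)
  solve-for-s s c t X T K i₃ iK Ti₃≡1 KiK≡1 eq = begin
    s                                                  ≡⟨ step₁ s ⟩
    s ℚ.* (1ℚ ℚ.* 1ℚ)                                  ≡⟨ cong (s ℚ.*_) (cong₂ ℚ._*_ Ti₃≡1 KiK≡1) ⟨
    s ℚ.* ((T ℚ.* i₃) ℚ.* (K ℚ.* iK))                  ≡⟨ step₂ s T i₃ K iK ⟩
    T ℚ.* K ℚ.* s ℚ.* i₃ ℚ.* iK                        ≡⟨ cong (λ u → u ℚ.* i₃ ℚ.* iK) eq ⟩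
    (c ℚ.* K ℚ.* t ℚ.- T ℚ.* c ℚ.* X) ℚ.* i₃ ℚ.* iK    ≡⟨ step₃ c K t T X i₃ iK ⟩
    c ℚ.* t ℚ.* i₃ ℚ.* (K ℚ.* iK) ℚ.- c ℚ.* X ℚ.* iK ℚ.* (T ℚ.* i₃)
      ≡⟨ cong₂ (λ u v → c ℚ.* t ℚ.* i₃ ℚ.* u ℚ.- c ℚ.* X ℚ.* iK ℚ.* v) KiK≡1 Ti₃≡1 ⟩
    c ℚ.* t ℚ.* i₃ ℚ.* 1ℚ ℚ.- c ℚ.* X ℚ.* iK ℚ.* 1ℚ    ≡⟨ step₄ c t i₃ X iK ⟩
    c ℚ.* ((t ℚ.* i₃) ℚ.* 1ℚ ℚ.- iK ℚ.* X)             ∎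
    where
    open ≡-Reasoning
    open +-*-Solver
    step₁ : ∀ s → s ≡ s ℚ.* (1ℚ ℚ.* 1ℚ)
    step₁ = solve 1 (λ s → s := s :* (con 1ℚ :* con 1ℚ)) refl
    step₂ : ∀ s T i₃ K iK → s ℚ.* ((T ℚ.* i₃) ℚ.* (K ℚ.* iK)) ≡ T ℚ.* K ℚ.* s ℚ.* i₃ ℚ.* iK
    step₂ = solve 5 (λ s T i₃ K iK → s :* ((T :* i₃) :* (K :* iK)) := T :* K :* s :* i₃ :* iK) refl
    step₃ : ∀ c K t T X i₃ iK → (c ℚ.* K ℚ.* t ℚ.- T ℚ.* c ℚ.* X) ℚ.* i₃ ℚ.* iK
                                ≡ c ℚ.* t ℚ.* i₃ ℚ.* (K ℚ.* iK) ℚ.- c ℚ.* X ℚ.* iK ℚ.* (T ℚ.* i₃)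
    step₃ = solve 7 (λ c K t T X i₃ iK → (c :* K :* t :- T :* c :* X) :* i₃ :* iK
                                         := c :* t :* i₃ :* (K :* iK) :- c :* X :* iK :* (T :* i₃)) refl
    step₄ : ∀ c t i₃ X iK → c ℚ.* t ℚ.* i₃ ℚ.* 1ℚ ℚ.- c ℚ.* X ℚ.* iK ℚ.* 1ℚ ≡ c ℚ.* ((t ℚ.* i₃) ℚ.* 1ℚ ℚ.- iK ℚ.* X)
    step₄ = solve 5 (λ c t i₃ X iK → c :* t :* i₃ :* con 1ℚ :- c :* X :* iK :* con 1ℚ
                                     := c :* ((t :* i₃) :* con 1ℚ :- iK :* X)) refl

  mean-from-integers : ∀ {S c t k : ℕ} {X : ℤ} →
    + 3 ℤ.* + suc k ℤ.* + S ≡ + c ℤ.* + suc k ℤ.* + t ℤ.- + 3 ℤ.* + c ℤ.* X →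
    ι (+ S) ≡ ι (+ c) ℚ.* ((+ t / 3) ℚ.* 1ℚ ℚ.- (+ 1 / suc k) ℚ.* ι X)
  mean-from-integers {S} {c} {t} {k} {X} eq = trans
    (solve-for-s (ι (+ S)) (ι (+ c)) (ι (+ t)) (ι X) (ι (+ 3)) (ι (+ suc k)) (+ 1 / 3) (+ 1 / suc k)
                 (/-inverse 2) (/-inverse k) in-ℚ)
    (cong (λ u → ι (+ c) ℚ.* (u ℚ.* 1ℚ ℚ.- (+ 1 / suc k) ℚ.* ι X)) (sym (/3-as-* t)))
    where
    in-ℚ : ι (+ 3) ℚ.* ι (+ suc k) ℚ.* ι (+ S) ≡ ι (+ c) ℚ.* ι (+ suc k) ℚ.* ι (+ t) ℚ.- ι (+ 3) ℚ.* ι (+ c) ℚ.* ι X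
    in-ℚ = begin
      ι (+ 3) ℚ.* ι (+ suc k) ℚ.* ι (+ S)
        ≡⟨ trans (ι-* (+ 3 ℤ.* + suc k) (+ S)) (cong (ℚ._* ι (+ S)) (ι-* (+ 3) (+ suc k))) ⟨
      ι (+ 3 ℤ.* + suc k ℤ.* + S)
        ≡⟨ cong ι eq ⟩
      ι (+ c ℤ.* + suc k ℤ.* + t ℤ.- + 3 ℤ.* + c ℤ.* X)
        ≡⟨ ι-- (+ c ℤ.* + suc k ℤ.* + t) (+ 3 ℤ.* + c ℤ.* X) ⟩
      ι (+ c ℤ.* + suc k ℤ.* + t) ℚ.- ι (+ 3 ℤ.* + c ℤ.* X)
        ≡⟨ cong₂ ℚ._-_ (trans (ι-* (+ c ℤ.* + suc k) (+ t)) (cong (ℚ._* ι (+ t)) (ι-* (+ c) (+ suc k))))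
                       (trans (ι-* (+ 3 ℤ.* + c) X) (cong (ℚ._* ι X) (ι-* (+ 3) (+ c)))) ⟩
      ι (+ c) ℚ.* ι (+ suc k) ℚ.* ι (+ t) ℚ.- ι (+ 3) ℚ.* ι (+ c) ℚ.* ι X ∎
      where open ≡-Reasoning

  integer-mean : ∀ (K S c P t r X : ℤ) →
    + 6 ℤ.* K ℤ.* S ℤ.+ + 2 ℤ.* c ℤ.* P ≡ + 2 ℤ.* c ℤ.* (K ℤ.* t) ℤ.+ + 6 ℤ.* c ℤ.* r →
    + 6 ℤ.* X ≡ + 2 ℤ.* P ℤ.- + 6 ℤ.* r →
    + 3 ℤ.* K ℤ.* S ≡ c ℤ.* K ℤ.* t ℤ.- + 3 ℤ.* c ℤ.* X
  integer-mean K S c P t r X peaks characters = ℤ.*-cancelˡ-≡ (+ 2) _ _ (begin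
    + 2 ℤ.* (+ 3 ℤ.* K ℤ.* S)
      ≡⟨ step₁ K S c P ⟩
    (+ 6 ℤ.* K ℤ.* S ℤ.+ + 2 ℤ.* c ℤ.* P) ℤ.- + 2 ℤ.* c ℤ.* P
      ≡⟨ cong (ℤ._- + 2 ℤ.* c ℤ.* P) peaks ⟩
    (+ 2 ℤ.* c ℤ.* (K ℤ.* t) ℤ.+ + 6 ℤ.* c ℤ.* r) ℤ.- + 2 ℤ.* c ℤ.* P
      ≡⟨ step₂ K c P t r ⟩
    + 2 ℤ.* c ℤ.* (K ℤ.* t) ℤ.- c ℤ.* (+ 2 ℤ.* P ℤ.- + 6 ℤ.* r)
      ≡⟨ cong (λ u → + 2 ℤ.* c ℤ.* (K ℤ.* t) ℤ.- c ℤ.* u) characters ⟨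
    + 2 ℤ.* c ℤ.* (K ℤ.* t) ℤ.- c ℤ.* (+ 6 ℤ.* X)
      ≡⟨ step₃ K c t X ⟩
    + 2 ℤ.* (c ℤ.* K ℤ.* t ℤ.- + 3 ℤ.* c ℤ.* X) ∎)
    where
    open ≡-Reasoning
    step₁ : ∀ K S c P → + 2 ℤ.* (+ 3 ℤ.* K ℤ.* S) ≡ (+ 6 ℤ.* K ℤ.* S ℤ.+ + 2 ℤ.* c ℤ.* P) ℤ.- + 2 ℤ.* c ℤ.* P
    step₁ = solve-∀
    step₂ : ∀ K c P t r → (+ 2 ℤ.* c ℤ.* (K ℤ.* t) ℤ.+ + 6 ℤ.* c ℤ.* r) ℤ.- + 2 ℤ.* c ℤ.* P
                          ≡ + 2 ℤ.* c ℤ.* (K ℤ.* t) ℤ.- c ℤ.* (+ 2 ℤ.* P ℤ.- + 6 ℤ.* r)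
    step₂ = solve-∀
    step₃ : ∀ K c t X → + 2 ℤ.* c ℤ.* (K ℤ.* t) ℤ.- c ℤ.* (+ 6 ℤ.* X) ≡ + 2 ℤ.* (c ℤ.* K ℤ.* t ℤ.- + 3 ℤ.* c ℤ.* X)
    step₃ = solve-∀

  pos-*³ : ∀ a b d → + (a ℕ.* b ℕ.* d) ≡ + a ℤ.* + b ℤ.* + d
  pos-*³ a b d = trans (ℤ.pos-* (a ℕ.* b) d) (cong (ℤ._* + d) (ℤ.pos-* a b))

  falling-factorial : ∀ p → + (p ℕ.* (p ∸ 1) ℕ.* (p ∸ 2)) ≡ + p ℤ.* (+ p ℤ.- 1ℤ) ℤ.* (+ p ℤ.- + 2)
  falling-factorial 0             = refl
  falling-factorial 1             = refl
  falling-factorial (suc (suc q)) = pos-*³ (suc (suc q)) (suc q) q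

open import Data.Nat using (ℕ; _+_; _*_; _∸_)
open import Data.Nat.ListAction using (sum)
open import Data.Integer using (+_)
open import Data.Rational using (ℚ; _/_) renaming (_+_ to _+ℚ_; _*_ to _*ℚ_; _-_ to _-ℚ_)
open import Data.List using (List; []; _∷_; length; map)
open import Data.List.Relation.Unary.Unique.Propositional using (Unique)
open import Data.List.Membership.Propositional using (_∈_)
open import Data.Product using (_×_)
open import Function.Bundles using (_⇔_)
open import Relation.Binary.PropositionalEquality using (_≡_)

import Data.Integer as ℤ
import Data.Integer.Properties as ℤ
import Data.Nat as ℕ
open import Data.Product using (_,_)
open import Data.Rational using (1ℚ)
open import Relation.Binary.PropositionalEquality using (cong; cong₂; sym; trans; module ≡-Reasoning)
open Characters using (mult; χ[a]; χ-sum)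
open PeakSums using (IsConjugacyClass; module WindowClassSums)
open Rationals using (ι; ι-+; mean-from-integers; integer-mean; pos-*³; falling-factorial)

peak-sum-ℤ : ∀ {m λp} {C : List (Perm (3 + m))} → Unique C → IsConjugacyClass λp C →
  let n = 3 + m; K = n * (n ∸ 1); p = mult 1 λp; c = + length C in
  + 6 ℤ.* + K ℤ.* + sum (map peak C) ℤ.+ + 2 ℤ.* c ℤ.* (+ p ℤ.* (+ p ℤ.- ℤ.1ℤ) ℤ.* (+ p ℤ.- + 2))
    ≡ + 2 ℤ.* c ℤ.* (+ K ℤ.* + (n ∸ 2)) ℤ.+ + 6 ℤ.* c ℤ.* + mult 3 λp
peak-sum-ℤ {m} {λp} {C} C-unique C-class = begin
  + 6 ℤ.* + K ℤ.* + S ℤ.+ + 2 ℤ.* + c ℤ.* (+ p ℤ.* (+ p ℤ.- ℤ.1ℤ) ℤ.* (+ p ℤ.- + 2))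
    ≡⟨ cong₂ ℤ._+_ (pos-*³ 6 K S) (trans (pos-*³ 2 c _) (cong (+ 2 ℤ.* + c ℤ.*_) (falling-factorial p))) ⟨
  + (6 * K * S) ℤ.+ + (2 * c * (p * (p ∸ 1) * (p ∸ 2)))
    ≡⟨ cong +_ peak-sum ⟩
  + (2 * c * (K * t) + 6 * c * r)
    ≡⟨ cong₂ ℤ._+_ (trans (pos-*³ 2 c (K * t)) (cong (+ 2 ℤ.* + c ℤ.*_) (ℤ.pos-* K t))) (pos-*³ 6 c r) ⟩
  + 2 ℤ.* + c ℤ.* (+ K ℤ.* + t) ℤ.+ + 6 ℤ.* + c ℤ.* + r ∎
  where
  open ≡-Reasoning
  open WindowClassSums {λp = λp} C-unique C-class using (peak-sum)
  n = 3 + m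
  K = n * (n ∸ 1)
  t = n ∸ 2
  S = sum (map peak C)
  c = length C
  p = mult 1 λp
  r = mult 3 λp

corollary4p6 : (m : ℕ) → let n = 3 + m in
    (λp : List ℕ) → IsPartition n λp →
    (C : List (Perm n)) → Unique C →
    (∀ (π : Perm n) → (π ∈ C) ⇔ (IsPerm π × HasCycleType π λp)) →
    (+ sum (map peak C) / 1)
      ≡ (+ length C / 1) *ℚ
        ( ((+ (n ∸ 2) / 3) *ℚ (χ (n ∷ []) λp / 1))
          -ℚ ((+ 1 / (n * (n ∸ 1)))
              *ℚ ((χ ((n ∸ 1) ∷ 1 ∷ []) λp / 1)
                  +ℚ (χ ((n ∸ 2) ∷ 2 ∷ []) λp / 1)
                  +ℚ (χ ((n ∸ 2) ∷ 1 ∷ 1 ∷ []) λp / 1)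
                  +ℚ (χ ((n ∸ 3) ∷ 2 ∷ 1 ∷ []) λp / 1))) )
corollary4p6 m λp (_ , pos , hs) C C-unique C-class = begin
  ι (+ S)
    ≡⟨ mean-from-integers {S} {c} {t} {ℕ.pred K} {X}
         (integer-mean (+ K) (+ S) (+ c) P (+ t) (+ mult 3 λp) X (peak-sum-ℤ {m} {λp} C-unique C-class) (χ-sum m pos hs)) ⟩
  ι (+ c) *ℚ ((+ t / 3) *ℚ 1ℚ -ℚ (+ 1 / K) *ℚ ι X)
    ≡⟨ cong₂ (λ u v → ι (+ c) *ℚ ((+ t / 3) *ℚ u -ℚ (+ 1 / K) *ℚ v)) (cong ι (sym (χ[a] n pos hs))) split ⟩
  ι (+ c) *ℚ ((+ t / 3) *ℚ ι (χ (n ∷ []) λp) -ℚ (+ 1 / K) *ℚ (ι A +ℚ ι B +ℚ ι C′ +ℚ ι D)) ∎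
  where
  open ≡-Reasoning
  n = 3 + m
  K = n * (n ∸ 1)
  t = n ∸ 2
  S = sum (map peak C)
  c = length C
  p = + mult 1 λp
  P = p ℤ.* (p ℤ.- ℤ.1ℤ) ℤ.* (p ℤ.- + 2)
  A = χ ((n ∸ 1) ∷ 1 ∷ []) λp
  B = χ ((n ∸ 2) ∷ 2 ∷ []) λp
  C′ = χ ((n ∸ 2) ∷ 1 ∷ 1 ∷ []) λp
  D = χ ((n ∸ 3) ∷ 2 ∷ 1 ∷ []) λp
  X = A ℤ.+ B ℤ.+ C′ ℤ.+ D
  split : ι X ≡ ι A +ℚ ι B +ℚ ι C′ +ℚ ι D
  split = trans (ι-+ (A ℤ.+ B ℤ.+ C′) D) (cong (_+ℚ ι D) (trans (ι-+ (A ℤ.+ B) C′) (cong (_+ℚ ι C′) (ι-+ A B))))
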